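{- Let $\alpha,\beta$ be non-negative integers, $k\ge1$, let $p_1,\ldots,p_k$ be distinct primes with $\gcd(p_i,6)=1$, let $\alpha_1,\ldots,\alpha_k$ be positive integers, and let $n=2^{\alpha}3^{\beta}\prod_{i=1}^{k}p_i^{\alpha_i}>12$. Let $R'=\{r_i: p_i\equiv r_i\pmod{12},\ 0\le r_i\le 11,\ 1\le i\le k\}$ be the set of residues of the $p_i$ modulo $12$. Then: (i) if $\alpha\in\{0,1\}$, $\beta=0$ and $R'=\{7,11\}$ or $\{7\}$: $\varphi_{12}(n)=\frac1{12}\varphi(n)+\frac14(-1)^{\Omega(n)}2^{\omega(n)-\alpha}$; (ii) if $\alpha\in\{0,1\}$, $\beta\ge2$ and $R'=\{7,11\}$, $\{7\}$ or $\{11\}$: $\varphi_{12}(n)=\frac1{12}\varphi(n)+\frac14(-1)^{\Omega(n)+1}2^{\omega(n)-\alpha}$; (iii) if either $\alpha\in\{0,1,2\}$, $\beta\in\{0,1\}$ and $R'=\{5,11\}$ or $\{5\}$; or $\alpha\in\{0,1\}$, $\beta=1$ and $R'=\{11\}$; or $\alpha=2$, $\beta\in\{0,1\}$ and $R'=\{11\}$: $\varphi_{12}(n)=\frac1{12}\varphi(n)+\frac16(-1)^{\Omega(n)+\lfloor(\alpha+1)/2\rfloor}2^{\omega(n)-\lfloor(\alpha+1)/2\rfloor-\beta}$; (iv) if $\alpha\ge3$, $\beta\in\{0,1\}$ and $R'=\{5,11\}$, $\{5\}$ or $\{11\}$: $\varphi_{12}(n)=\frac1{12}\varphi(n)+\frac16(-1)^{\Omega(n)}2^{\omega(n)-\beta}$;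 (v) if $\alpha=0$, $\beta=0$ and $R'=\{11\}$: $\varphi_{12}(n)=\frac1{12}\varphi(n)+\frac5{12}(-1)^{\Omega(n)}2^{\omega(n)}$; (vi) if $\alpha=1$, $\beta=0$ and $R'=\{11\}$: $\varphi_{12}(n)=\frac1{12}\varphi(n)+\frac1{12}(-1)^{\Omega(n)}2^{\omega(n)-1}$; (vii) in all other cases: $\varphi_{12}(n)=\frac1{12}\varphi(n)$.
   Context: For positive integers $n,e$, the generalized Euler function is $\varphi_e(n)=\#\{i\in\mathbb{Z}: 1\le i\le \lfloor n/e\rfloor,\ \gcd(i,n)=1\}$; $\varphi=\varphi_1$ is Euler's function. $\Omega(n)$ denotes the number of prime factors of $n$ counted with multiplicity and $\omega(n)$ the number of distinct prime factors of $n$. $\lfloor x\rfloor$ is the greatest integer not exceeding $x$. Conditions such as "$R'=\{7,11\}$" mean equality of sets. -}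

module Defs where

open import Data.Nat as ℕ using (ℕ; zero; suc; _∸_; _^_; NonZero)
open import Data.Nat.GCD using (gcd)
open import Data.Nat.Divisibility using (_∣_; _∣?_)
open import Data.Nat.Primality using (Prime; prime?)
open import Data.Nat.Properties using (_≟_)
open import Data.List using (List; []; _∷_; length; filter; map; upTo; concatMap; tabulate)
open import Data.Nat.ListAction using (product)
open import Data.List.Membership.Propositional using (_∈_)
open import Data.Fin using (Fin)
open import Data.Product using (_×_; _,_; ∃)
open import Data.Integer using (ℤ; +_)
open import Data.Rational using (ℚ; 0ℚ; 1ℚ; -_; _+_; _*_)
import Data.Rational as ℚ
open import Relation.Nullary.Decidable using (_×-dec_)
open import Relation.Binary.PropositionalEquality using (_≡_)
open import Data.Sum using (_⊎_)

oneTo : ℕ → List ℕ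
oneTo m = map suc (upTo m)

φ[_] : (e : ℕ) → .{{NonZero e}} → ℕ → ℕ
φ[ e ] n = length (filter (λ i → gcd i n ≟ 1) (oneTo (n ℕ./ e)))

φ : ℕ → ℕ
φ n = φ[ 1 ] n

-- ω(n): number of distinct primes dividing n (for n ≥ 1 these are all ≤ n)
ω : ℕ → ℕ
ω n = length (filter (λ p → prime? p ×-dec (p ∣? n)) (oneTo n))

-- Ω(n) = Σ_p v_p(n) = #{ (p, j) : p prime, j ≥ 1, p^j ∣ n }  (for n ≥ 1, p, j ≤ n)
Ω : ℕ → ℕ
Ω n = length (filter (λ pj → prime? (Data.Product.proj₁ pj) ×-dec
                              ((Data.Product.proj₁ pj ^ Data.Product.proj₂ pj) ∣? n))
                     (concatMap (λ p → map (λ j → (p , j)) (oneTo n)) (oneTo n)))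

⟦_⟧ : ℕ → ℚ
⟦ m ⟧ = (+ m) ℚ./ 1

_÷_ : ℕ → (b : ℕ) → .{{NonZero b}} → ℚ
a ÷ b = (+ a) ℚ./ b

sgn : ℕ → ℚ
sgn zero = 1ℚ
sgn (suc m) = - sgn m

-- the set R' = { p_i mod 12 : i } equals the finite set S (given as a list)
ResiduesAre : {k : ℕ} → (Fin k → ℕ) → List ℕ → Set
ResiduesAre {k} p S = (∀ i → (p i ℕ.% 12) ∈ S) × (∀ r → r ∈ S → ∃ λ i → p i ℕ.% 12 ≡ r)

prodPow : {k : ℕ} → (Fin k → ℕ) → (Fin k → ℕ) → ℕ
prodPow p a = product (tabulate (λ i → p i ^ a i))

Case-i : ℕ → ℕ → {k : ℕ} → (Fin k → ℕ) → Set
Case-i α β p = α ℕ.≤ 1 × β ≡ 0 × (ResiduesAre p (7 ∷ 11 ∷ []) ⊎ ResiduesAre p (7 ∷ []))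

Case-ii : ℕ → ℕ → {k : ℕ} → (Fin k → ℕ) → Set
Case-ii α β p = α ℕ.≤ 1 × 2 ℕ.≤ β ×
  (ResiduesAre p (7 ∷ 11 ∷ []) ⊎ ResiduesAre p (7 ∷ []) ⊎ ResiduesAre p (11 ∷ []))

Case-iii : ℕ → ℕ → {k : ℕ} → (Fin k → ℕ) → Set
Case-iii α β p =
    (α ℕ.≤ 2 × β ℕ.≤ 1 × (ResiduesAre p (5 ∷ 11 ∷ []) ⊎ ResiduesAre p (5 ∷ [])))
  ⊎ (α ℕ.≤ 1 × β ≡ 1 × ResiduesAre p (11 ∷ []))
  ⊎ (α ≡ 2 × β ℕ.≤ 1 × ResiduesAre p (11 ∷ []))

Case-iv : ℕ → ℕ → {k : ℕ} → (Fin k → ℕ) → Set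
Case-iv α β p = 3 ℕ.≤ α × β ℕ.≤ 1 ×
  (ResiduesAre p (5 ∷ 11 ∷ []) ⊎ ResiduesAre p (5 ∷ []) ⊎ ResiduesAre p (11 ∷ []))

Case-v : ℕ → ℕ → {k : ℕ} → (Fin k → ℕ) → Set
Case-v α β p = α ≡ 0 × β ≡ 0 × ResiduesAre p (11 ∷ [])

Case-vi : ℕ → ℕ → {k : ℕ} → (Fin k → ℕ) → Set
Case-vi α β p = α ≡ 1 × β ≡ 0 × ResiduesAre p (11 ∷ [])

-- Write C(m, x) for the number of 1 ≤ i ≤ x coprime to m, so that φ₁₂(n) = C(n, ⌊n/12⌋) and
-- φ(n) = C(n, n), and consider the defect D(m, t) = 12 C(m, ⌊mt/12⌋) − t φ(m), with
-- D(n, 1) = 12 φ₁₂(n) − φ(n).  One has D(1, t) = −(t mod 12), and sieving out the multiples of a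
-- prime p ∤ m gives D(m p^(a+1), t) = D(m, p^(a+1) t) − D(m, p^a t).  So D(m, t) depends only on
-- t mod 12, i.e. D(m, ·) is a vector in ℤ¹², and each prime power p^(a+1) ∥ n acts on it by the
-- twist T_{c,d} v (t) = v(c t) − v(d t), where c, d are the residues of p^(a+1), p^a.  For
-- p ≢ 1 (mod 12) these residues are p and 1 in some order, the twists T_{5,1}, T_{7,1}, T_{11,1}
-- commute and satisfy T_{c,1}² = −2 T_{c,1}; a prime p ≡ 1 (mod 12) annihilates everything.  So
-- the primes p_i contribute ±2^(k − |R'|) times one twist for each residue in R', applied to the
-- vector of 2^α 3^β.  The value at t = 1 of the result depends on α and β through finitely many
-- classes only, and evaluating it gives cases (i)–(vi) and zero otherwise.

module Submission where

open import Defs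
open import Data.Nat using (ℕ; _≤_; _<_; _^_; _∸_; _/_)
import Data.Nat as ℕ
open import Data.Nat.GCD using (gcd)
open import Data.Nat.Primality using (Prime)
open import Data.Fin using (Fin)
open import Data.Product using (_×_; _,_)
open import Data.Sum using (_⊎_)
open import Relation.Nullary using (¬_)
open import Relation.Binary.PropositionalEquality using (_≡_)

module Counting where

  open import Defs using (oneTo)
  open import Data.Nat
  open import Data.Nat.Properties
  open import Data.Nat.DivMod
  open import Data.Nat.Divisibility
  open import Data.Nat.GCD using (gcd; gcd-zeroʳ)
  open import Data.Nat.Coprimality using (Coprime; coprime⇒gcd≡1; gcd≡1⇒coprime; coprime-divisor)
  import Data.Nat.Coprimality as Coprime
  open import Data.Nat.Primality using (Prime; prime⇒irreducible; prime⇒nonZero; prime⇒nonTrivial)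
  open import Data.List using (length; filter; map; upTo; _++_; [_])
  open import Data.List.Properties using (upTo-∷ʳ; map-++; length-++; filter-++; filter-all; length-map; length-upTo)
  import Data.List.Relation.Unary.All as All
  open import Data.Product using (_,_)
  open import Data.Sum using (inj₁; inj₂)
  open import Function using (_∘_)
  open import Relation.Nullary using (Dec; yes; no; ¬_; contradiction)
  open import Relation.Unary using (Decidable)
  open import Relation.Binary.PropositionalEquality hiding ([_])
  open ≡-Reasoning

  indicator : {P : Set} → Dec P → ℕ
  indicator (yes _) = 1
  indicator (no _) = 0

  indicator-yes : {P : Set} (P? : Dec P) → P → indicator P? ≡ 1
  indicator-yes (yes _) _ = refl
  indicator-yes (no ¬p) p = contradiction p ¬p

  indicator-no : {P : Set} (P? : Dec P) → ¬ P → indicator P? ≡ 0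
  indicator-no (yes p) ¬p = contradiction p ¬p
  indicator-no (no _) _ = refl

  indicator-cong : {P Q : Set} (P? : Dec P) (Q? : Dec Q) → (P → Q) → (Q → P) → indicator P? ≡ indicator Q?
  indicator-cong (yes _) (yes _) _ _ = refl
  indicator-cong (yes p) (no ¬q) f _ = contradiction (f p) ¬q
  indicator-cong (no ¬p) (yes q) _ g = contradiction (g q) ¬p
  indicator-cong (no _) (no _) _ _ = refl

  countTo : {P : ℕ → Set} → Decidable P → ℕ → ℕ
  countTo P? x = length (filter P? (oneTo x))

  oneTo-suc : ∀ x → oneTo (suc x) ≡ oneTo x ++ [ suc x ]
  oneTo-suc x = trans (cong (map suc) (sym (upTo-∷ʳ x))) (map-++ suc (upTo x) [ x ])

  countTo-suc : {P : ℕ → Set} (P? : Decidable P) (x : ℕ) →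
    countTo P? (suc x) ≡ countTo P? x + indicator (P? (suc x))
  countTo-suc P? x = begin
    length (filter P? (oneTo (suc x)))               ≡⟨ cong (length ∘ filter P?) (oneTo-suc x) ⟩
    length (filter P? (oneTo x ++ [ suc x ]))        ≡⟨ cong length (filter-++ P? (oneTo x) [ suc x ]) ⟩
    length (filter P? (oneTo x) ++ filter P? [ suc x ]) ≡⟨ length-++ (filter P? (oneTo x)) ⟩
    countTo P? x + length (filter P? [ suc x ])      ≡⟨ cong (countTo P? x +_) singleton ⟩
    countTo P? x + indicator (P? (suc x))            ∎
    where
    singleton : length (filter P? [ suc x ]) ≡ indicator (P? (suc x))
    singleton with P? (suc x)
    ... | yes _ = refl
    ... | no _ = refl

  coprimeCount : ℕ → ℕ → ℕ
  coprimeCount m = countTo (λ i → gcd i m ≟ 1)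

  coprimeCount-1 : ∀ x → coprimeCount 1 x ≡ x
  coprimeCount-1 x = begin
    length (filter (λ i → gcd i 1 ≟ 1) (oneTo x)) ≡⟨ cong length (filter-all (λ i → gcd i 1 ≟ 1) {oneTo x} (All.tabulate (λ {i} _ → gcd-zeroʳ i))) ⟩
    length (oneTo x)                              ≡⟨ length-map suc (upTo x) ⟩
    length (upTo x)                               ≡⟨ length-upTo x ⟩
    x                                             ∎

  coprimeIndicator : ℕ → ℕ → ℕ
  coprimeIndicator m i = indicator (gcd i m ≟ 1)

  coprimeCount-suc : ∀ m x → coprimeCount m (suc x) ≡ coprimeCount m x + coprimeIndicator m (suc x)
  coprimeCount-suc m = countTo-suc (λ i → gcd i m ≟ 1)

  coprimeIndicator-cong : ∀ {m m′ i i′} → (Coprime i m → Coprime i′ m′) → (Coprime i′ m′ → Coprime i m) →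
    coprimeIndicator m i ≡ coprimeIndicator m′ i′
  coprimeIndicator-cong {m} {m′} {i} {i′} f g = indicator-cong (gcd i m ≟ 1) (gcd i′ m′ ≟ 1)
    (λ e → coprime⇒gcd≡1 (f (gcd≡1⇒coprime e))) (λ e → coprime⇒gcd≡1 (g (gcd≡1⇒coprime e)))

  coprimeIndicator-≡0 : ∀ {m i} → ¬ Coprime i m → coprimeIndicator m i ≡ 0
  coprimeIndicator-≡0 {m} {i} ¬c = indicator-no (gcd i m ≟ 1) (λ g≡1 → ¬c (λ {d} → gcd≡1⇒coprime g≡1 {d}))

  coprime-*ʳ : ∀ {a b c} → Coprime a b → Coprime a c → Coprime a (b * c)
  coprime-*ʳ a⊥b a⊥c (d∣a , d∣bc) = a⊥c (d∣a , coprime-divisor (λ (e∣d , e∣b) → a⊥b (∣-trans e∣d d∣a , e∣b)) d∣bc)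

  coprime-^ʳ : ∀ {j p} a → Coprime j p → Coprime j (p ^ a)
  coprime-^ʳ zero _ (_ , d∣1) = ∣1⇒≡1 d∣1
  coprime-^ʳ (suc a) j⊥p = coprime-*ʳ j⊥p (coprime-^ʳ a j⊥p)

  coprime-∣ˡ : ∀ {a b d} → Coprime a b → d ∣ a → Coprime d b
  coprime-∣ˡ a⊥b d∣a (e∣d , e∣b) = a⊥b (∣-trans e∣d d∣a , e∣b)

  coprime-∣ʳ : ∀ {a b d} → Coprime a b → d ∣ b → Coprime a d
  coprime-∣ʳ a⊥b d∣b (e∣a , e∣d) = a⊥b (e∣a , ∣-trans e∣d d∣b)

  prime-∤⇒coprime : ∀ {p j} → Prime p → ¬ p ∣ j → Coprime j p
  prime-∤⇒coprime pp p∤j (d∣j , d∣p) with prime⇒irreducible pp d∣p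
  ... | inj₁ d≡1 = d≡1
  ... | inj₂ refl = contradiction d∣j p∤j

  coprimeCount-+ : ∀ m x → coprimeCount m (x + m) ≡ coprimeCount m x + coprimeCount m m
  coprimeCount-+ m zero = refl
  coprimeCount-+ m (suc x) = begin
    coprimeCount m (suc x + m)                                   ≡⟨ coprimeCount-suc m (x + m) ⟩
    coprimeCount m (x + m) + coprimeIndicator m (suc x + m)      ≡⟨ cong₂ _+_ (coprimeCount-+ m x) shift ⟩
    coprimeCount m x + coprimeCount m m + coprimeIndicator m (suc x) ≡⟨ +-assoc (coprimeCount m x) _ _ ⟩
    coprimeCount m x + (coprimeCount m m + coprimeIndicator m (suc x)) ≡⟨ cong (coprimeCount m x +_) (+-comm (coprimeCount m m) _) ⟩
    coprimeCount m x + (coprimeIndicator m (suc x) + coprimeCount m m) ≡⟨ +-assoc (coprimeCount m x) _ _ ⟨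
    coprimeCount m x + coprimeIndicator m (suc x) + coprimeCount m m ≡⟨ cong (_+ coprimeCount m m) (coprimeCount-suc m x) ⟨
    coprimeCount m (suc x) + coprimeCount m m                    ∎
    where
    shift : coprimeIndicator m (suc x + m) ≡ coprimeIndicator m (suc x)
    shift = coprimeIndicator-cong {m} {m} {suc x + m} {suc x}
      (λ c (d∣i , d∣m) → c (∣m∣n⇒∣m+n d∣i d∣m , d∣m))
      (λ c {d} (d∣i , d∣m) → c (∣m+n∣m⇒∣n (subst (d ∣_) (+-comm (suc x) m) d∣i) d∣m , d∣m))

  coprimeCount-periodic : ∀ m q r → coprimeCount m (q * m + r) ≡ q * coprimeCount m m + coprimeCount m r
  coprimeCount-periodic m zero r = refl
  coprimeCount-periodic m (suc q) r = begin
    coprimeCount m (m + q * m + r)                      ≡⟨ cong (coprimeCount m) (trans (+-assoc m (q * m) r) (+-comm m _)) ⟩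
    coprimeCount m (q * m + r + m)                      ≡⟨ coprimeCount-+ m (q * m + r) ⟩
    coprimeCount m (q * m + r) + coprimeCount m m       ≡⟨ cong (_+ coprimeCount m m) (coprimeCount-periodic m q r) ⟩
    q * φm + coprimeCount m r + φm                      ≡⟨ +-assoc (q * φm) _ _ ⟩
    q * φm + (coprimeCount m r + φm)                    ≡⟨ cong (q * φm +_) (+-comm (coprimeCount m r) φm) ⟩
    q * φm + (φm + coprimeCount m r)                    ≡⟨ +-assoc (q * φm) _ _ ⟨
    q * φm + φm + coprimeCount m r                      ≡⟨ cong (_+ coprimeCount m r) (+-comm (q * φm) φm) ⟩
    φm + q * φm + coprimeCount m r                      ∎
    where φm = coprimeCount m m

  coprimeCount-*ˡ : ∀ m u → coprimeCount m (m * u) ≡ u * coprimeCount m m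
  coprimeCount-*ˡ m u = begin
    coprimeCount m (m * u)          ≡⟨ cong (coprimeCount m) (trans (*-comm m u) (sym (+-identityʳ (u * m)))) ⟩
    coprimeCount m (u * m + 0)      ≡⟨ coprimeCount-periodic m u 0 ⟩
    u * coprimeCount m m + 0        ≡⟨ +-identityʳ _ ⟩
    u * coprimeCount m m            ∎

  module _ {d : ℕ} .{{_ : NonZero d}} (x : ℕ) where
    private
      suc≡ : suc x ≡ x / d * d + suc (x % d)
      suc≡ = trans (cong suc (m≡m%n+[m/n]*n x d)) (+-comm (suc (x % d)) _)

    suc-/-nonMultiple : suc (x % d) < d → suc x / d ≡ x / d
    suc-/-nonMultiple r<d = begin
      suc x / d                          ≡⟨ cong (_/ d) suc≡ ⟩
      (x / d * d + suc (x % d)) / d      ≡⟨ +-distrib-/-∣ˡ (suc (x % d)) (n∣m*n (x / d)) ⟩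
      x / d * d / d + suc (x % d) / d    ≡⟨ cong₂ _+_ (m*n/n≡m (x / d) d) (m<n⇒m/n≡0 r<d) ⟩
      x / d + 0                          ≡⟨ +-identityʳ _ ⟩
      x / d                              ∎

    suc-nonMultiple : suc (x % d) < d → ¬ d ∣ suc x
    suc-nonMultiple r<d d∣ = 0≢1+n (begin
      0                                  ≡⟨ n∣m⇒m%n≡0 (suc x) d d∣ ⟨
      suc x % d                          ≡⟨ cong (_% d) suc≡ ⟩
      (x / d * d + suc (x % d)) % d      ≡⟨ %-remove-+ˡ (suc (x % d)) (n∣m*n (x / d)) ⟩
      suc (x % d) % d                    ≡⟨ m<n⇒m%n≡m r<d ⟩
      suc (x % d)                        ∎)

    suc-multiple : ¬ suc (x % d) < d → suc x ≡ d * suc (x / d)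
    suc-multiple r≮d = begin
      suc x                     ≡⟨ cong suc (m≡m%n+[m/n]*n x d) ⟩
      suc (x % d) + x / d * d   ≡⟨ cong (_+ x / d * d) (≤-antisym (m%n<n x d) (≮⇒≥ r≮d)) ⟩
      d + x / d * d             ≡⟨ cong (d +_) (*-comm (x / d) d) ⟩
      d + d * (x / d)           ≡⟨ *-suc d (x / d) ⟨
      d * suc (x / d)           ∎

  module _ {p m : ℕ} (a : ℕ) (p-prime : Prime p) (p∤m : ¬ p ∣ m) where
    private
      instance
        p≢0 : NonZero p
        p≢0 = prime⇒nonZero p-prime

      M : ℕ
      M = m * p ^ suc a

      multiple : ∀ {j} → p ∣ j → coprimeIndicator M j ≡ 0
      multiple p∣j = coprimeIndicator-≡0 (λ c → nonTrivial⇒≢1 ⦃ prime⇒nonTrivial p-prime ⦄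
        (c (p∣j , ∣n⇒∣m*n m (∣m⇒∣m*n (p ^ a) ∣-refl))))

      nonMultiple : ∀ {j} → ¬ p ∣ j → coprimeIndicator M j ≡ coprimeIndicator m j
      nonMultiple p∤j = coprimeIndicator-cong (λ c → coprime-∣ʳ c (m∣m*n (p ^ suc a)))
        (λ c → coprime-*ʳ c (coprime-^ʳ (suc a) (prime-∤⇒coprime p-prime p∤j)))

      times-p : ∀ j → coprimeIndicator m (p * j) ≡ coprimeIndicator m j
      times-p j = coprimeIndicator-cong (λ c → coprime-∣ˡ c (n∣m*n p))
        (λ c → Coprime.sym (coprime-*ʳ (prime-∤⇒coprime p-prime p∤m) (Coprime.sym c)))

    -- The integers up to x that are coprime to m are those coprime to M, together with the p j,
    -- j ≤ ⌊x/p⌋, with j coprime to m.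
    coprimeCount-sieve : ∀ x → coprimeCount M x + coprimeCount m (x / p) ≡ coprimeCount m x
    coprimeCount-sieve zero = cong (coprimeCount m) (0/n≡0 p)
    coprimeCount-sieve (suc x) with suc (x % p) <? p
    ... | yes r<p = begin
        coprimeCount M (suc x) + coprimeCount m (suc x / p)         ≡⟨ cong₂ _+_ (coprimeCount-suc M x) (cong (coprimeCount m) (suc-/-nonMultiple x r<p)) ⟩
        coprimeCount M x + coprimeIndicator M (suc x) + coprimeCount m (x / p) ≡⟨ cong (λ z → coprimeCount M x + z + coprimeCount m (x / p)) (nonMultiple (suc-nonMultiple x r<p)) ⟩
        coprimeCount M x + iₓ + coprimeCount m (x / p)            ≡⟨ +-assoc (coprimeCount M x) iₓ _ ⟩
        coprimeCount M x + (iₓ + coprimeCount m (x / p))          ≡⟨ cong (coprimeCount M x +_) (+-comm iₓ _) ⟩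
        coprimeCount M x + (coprimeCount m (x / p) + iₓ)          ≡⟨ +-assoc (coprimeCount M x) _ iₓ ⟨
        coprimeCount M x + coprimeCount m (x / p) + iₓ            ≡⟨ cong (_+ iₓ) (coprimeCount-sieve x) ⟩
        coprimeCount m x + iₓ                                     ≡⟨ coprimeCount-suc m x ⟨
        coprimeCount m (suc x)                                    ∎
      where
      iₓ : ℕ
      iₓ = coprimeIndicator m (suc x)
    ... | no r≮p = begin
        coprimeCount M (suc x) + coprimeCount m (suc x / p)        ≡⟨ cong₂ _+_ (coprimeCount-suc M x) (cong (coprimeCount m) quotient≡) ⟩
        coprimeCount M x + coprimeIndicator M (suc x) + coprimeCount m (suc (x / p)) ≡⟨ cong₂ (λ z w → coprimeCount M x + z + w) (multiple p∣suc-x) (coprimeCount-suc m (x / p)) ⟩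
        coprimeCount M x + 0 + (coprimeCount m (x / p) + coprimeIndicator m (suc (x / p))) ≡⟨ cong (_+ _) (+-identityʳ (coprimeCount M x)) ⟩
        coprimeCount M x + (coprimeCount m (x / p) + coprimeIndicator m (suc (x / p))) ≡⟨ +-assoc (coprimeCount M x) _ _ ⟨
        coprimeCount M x + coprimeCount m (x / p) + coprimeIndicator m (suc (x / p)) ≡⟨ cong₂ _+_ (coprimeCount-sieve x) (trans (sym (times-p _)) (cong (coprimeIndicator m) (sym suc-x≡))) ⟩
        coprimeCount m x + coprimeIndicator m (suc x)              ≡⟨ coprimeCount-suc m x ⟨
        coprimeCount m (suc x)                                     ∎
      where
      suc-x≡ : suc x ≡ p * suc (x / p)
      suc-x≡ = suc-multiple x r≮p
      quotient≡ : suc x / p ≡ suc (x / p)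
      quotient≡ = trans (cong (_/ p) (trans suc-x≡ (*-comm p _))) (m*n/n≡m (suc (x / p)) p)
      p∣suc-x : p ∣ suc x
      p∣suc-x = divides (suc (x / p)) (trans suc-x≡ (*-comm p _))

module Primes where

  open import Defs using (prodPow)
  open import Data.Nat
  open import Data.Nat.Divisibility using (_∣_; ∣1⇒≡1)
  open import Data.Nat.Primality using (Prime; prime?; euclidsLemma; prime⇒irreducible; prime⇒nonTrivial)
  open import Data.Fin using (Fin) renaming (zero to fzero; suc to fsuc)
  open import Data.Product using (∃; _,_)
  open import Data.Sum using (inj₁; inj₂)
  open import Data.Unit using (tt)
  open import Function using (_∘_)
  open import Relation.Nullary using (¬_; contradiction)
  open import Relation.Nullary.Decidable using (toWitness)
  open import Relation.Binary.PropositionalEquality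

  prime[3] : Prime 3
  prime[3] = toWitness {a? = prime? 3} tt

  prime∤1 : ∀ {p} → Prime p → ¬ p ∣ 1
  prime∤1 p-prime p∣1 = nonTrivial⇒≢1 ⦃ prime⇒nonTrivial p-prime ⦄ (∣1⇒≡1 p∣1)

  prime∣^⇒≡ : ∀ {p q} b → Prime p → Prime q → p ∣ q ^ b → p ≡ q
  prime∣^⇒≡ zero p-prime _ p∣1 = contradiction p∣1 (prime∤1 p-prime)
  prime∣^⇒≡ {p} {q} (suc b) p-prime q-prime p∣ with euclidsLemma q (q ^ b) p-prime p∣
  ... | inj₂ p∣q^b = prime∣^⇒≡ b p-prime q-prime p∣q^b
  ... | inj₁ p∣q with prime⇒irreducible q-prime p∣q
  ...   | inj₁ p≡1 = contradiction p≡1 (nonTrivial⇒≢1 ⦃ prime⇒nonTrivial p-prime ⦄)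
  ...   | inj₂ p≡q = p≡q

  prime∣prodPow : ∀ {k q} (p a : Fin k → ℕ) → Prime q → (∀ i → Prime (p i)) → q ∣ prodPow p a → ∃ λ i → q ≡ p i
  prime∣prodPow {zero} p a q-prime _ q∣1 = contradiction q∣1 (prime∤1 q-prime)
  prime∣prodPow {suc k} p a q-prime p-prime q∣ with euclidsLemma (p fzero ^ a fzero) (prodPow (p ∘ fsuc) (a ∘ fsuc)) q-prime q∣
  ... | inj₁ q∣p^a = fzero , prime∣^⇒≡ (a fzero) q-prime (p-prime fzero) q∣p^a
  ... | inj₂ q∣rest with prime∣prodPow (p ∘ fsuc) (a ∘ fsuc) q-prime (p-prime ∘ fsuc) q∣rest
  ...   | i , q≡pᵢ = fsuc i , q≡pᵢ

  prodPow-cong : ∀ {k} (p : Fin k → ℕ) {a b : Fin k → ℕ} → (∀ i → a i ≡ b i) → prodPow p a ≡ prodPow p b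
  prodPow-cong {zero} p _ = refl
  prodPow-cong {suc k} p a≗b = cong₂ _*_ (cong (p fzero ^_) (a≗b fzero)) (prodPow-cong (p ∘ fsuc) (a≗b ∘ fsuc))

module Defect (N : ℕ) .{{N≢0 : ℕ.NonZero N}} where

  open Counting
  open import Data.Nat as ℕ using (NonZero; zero; suc; _^_; _%_; _/_)
  import Data.Nat.Properties as ℕP
  open import Data.Nat.DivMod
  open import Data.Nat.Divisibility
  open import Data.Nat.Primality using (Prime; prime⇒nonZero)
  import Data.Nat.Tactic.RingSolver as ℕSolver
  open import Data.Integer as ℤ using (ℤ; +_; _-_; -_)
  import Data.Integer.Properties as ℤP
  import Data.Integer.Tactic.RingSolver as ℤSolver
  open import Data.Fin using (Fin; toℕ)
  open import Data.Fin.Properties using (toℕ<n; toℕ-fromℕ<; fromℕ<-cong; fromℕ<-toℕ)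
  open import Data.Vec using (Vec; lookup; tabulate; map; replicate)
  open import Data.Vec.Properties using (lookup∘tabulate; tabulate∘lookup; tabulate-cong; lookup-map; lookup-replicate)
  open import Relation.Nullary using (¬_)
  open import Function using (_∘_)
  open import Relation.Binary.PropositionalEquality
  open ≡-Reasoning

  pos-difference : ∀ a b c d → a ℕ.+ d ≡ b ℕ.+ c → + a - + b ≡ + c - + d
  pos-difference a b c d eq = begin
    + a - + b                        ≡⟨ addBoth (+ a) (+ b) (+ d) ⟩
    (+ a ℤ.+ + d) - + b - + d        ≡⟨ cong (λ z → z - + b - + d) (ℤP.pos-+ a d) ⟨
    + (a ℕ.+ d) - + b - + d          ≡⟨ cong (λ z → + z - + b - + d) eq ⟩
    + (b ℕ.+ c) - + b - + d          ≡⟨ cong (λ z → z - + b - + d) (ℤP.pos-+ b c) ⟩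
    (+ b ℤ.+ + c) - + b - + d        ≡⟨ cancel (+ b) (+ c) (+ d) ⟩
    + c - + d                        ∎
    where
    addBoth : ∀ x y z → x - y ≡ (x ℤ.+ z) - y - z
    addBoth = ℤSolver.solve-∀
    cancel : ∀ x y z → (x ℤ.+ y) - x - z ≡ y - z
    cancel = ℤSolver.solve-∀

  defect : ℕ → ℕ → ℤ
  defect m t = + (N ℕ.* coprimeCount m (m ℕ.* t / N)) - + (t ℕ.* coprimeCount m m)

  module _ {p m : ℕ} (a : ℕ) (p-prime : Prime p) (p∤m : ¬ p ∣ m) where
    private
      instance
        p≢0 : NonZero p
        p≢0 = prime⇒nonZero p-prime
        Np≢0 : NonZero (N ℕ.* p)
        Np≢0 = ℕP.m*n≢0 N p
        pN≢0 : NonZero (p ℕ.* N)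
        pN≢0 = ℕP.m*n≢0 p N

      P P′ M φm : ℕ
      P = p ^ suc a
      P′ = p ^ a
      M = m ℕ.* P
      φm = coprimeCount m m

      M≡ : M ≡ m ℕ.* P′ ℕ.* p
      M≡ = trans (cong (m ℕ.*_) (ℕP.*-comm p P′)) (sym (ℕP.*-assoc m P′ p))

      totient-step : coprimeCount M M ℕ.+ P′ ℕ.* φm ≡ P ℕ.* φm
      totient-step = begin
        coprimeCount M M ℕ.+ P′ ℕ.* φm                ≡⟨ cong (coprimeCount M M ℕ.+_) (coprimeCount-*ˡ m P′) ⟨
        coprimeCount M M ℕ.+ coprimeCount m (m ℕ.* P′) ≡⟨ cong (λ z → coprimeCount M M ℕ.+ coprimeCount m z) M/p≡ ⟨
        coprimeCount M M ℕ.+ coprimeCount m (M / p)    ≡⟨ coprimeCount-sieve a p-prime p∤m M ⟩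
        coprimeCount m M                               ≡⟨ coprimeCount-*ˡ m P ⟩
        P ℕ.* φm                                       ∎
        where
        M/p≡ : M / p ≡ m ℕ.* P′
        M/p≡ = trans (cong (_/ p) M≡) (m*n/n≡m (m ℕ.* P′) p)

      count-step : ∀ t → coprimeCount M (M ℕ.* t / N) ℕ.+ coprimeCount m (m ℕ.* (P′ ℕ.* t) / N)
                         ≡ coprimeCount m (m ℕ.* (P ℕ.* t) / N)
      count-step t = begin
        coprimeCount M (M ℕ.* t / N) ℕ.+ coprimeCount m (m ℕ.* (P′ ℕ.* t) / N) ≡⟨ cong (λ z → coprimeCount M (M ℕ.* t / N) ℕ.+ coprimeCount m z) quotient≡ ⟨
        coprimeCount M (M ℕ.* t / N) ℕ.+ coprimeCount m (M ℕ.* t / N / p)      ≡⟨ coprimeCount-sieve a p-prime p∤m (M ℕ.* t / N) ⟩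
        coprimeCount m (M ℕ.* t / N)                                           ≡⟨ cong (λ z → coprimeCount m (z / N)) (ℕP.*-assoc m P t) ⟩
        coprimeCount m (m ℕ.* (P ℕ.* t) / N)                                   ∎
        where
        shuffle : ∀ m x p t → m ℕ.* x ℕ.* p ℕ.* t ≡ m ℕ.* (x ℕ.* t) ℕ.* p
        shuffle = ℕSolver.solve-∀
        quotient≡ : M ℕ.* t / N / p ≡ m ℕ.* (P′ ℕ.* t) / N
        quotient≡ = begin
          M ℕ.* t / N / p                 ≡⟨ m/n/o≡m/[n*o] (M ℕ.* t) N p ⟩
          M ℕ.* t / (N ℕ.* p)             ≡⟨ /-congʳ (ℕP.*-comm N p) ⟩
          M ℕ.* t / (p ℕ.* N)             ≡⟨ m/n/o≡m/[n*o] (M ℕ.* t) p N ⟨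
          M ℕ.* t / p / N                 ≡⟨ cong (λ z → z ℕ.* t / p / N) M≡ ⟩
          m ℕ.* P′ ℕ.* p ℕ.* t / p / N    ≡⟨ cong (λ z → z / p / N) (shuffle m P′ p t) ⟩
          m ℕ.* (P′ ℕ.* t) ℕ.* p / p / N  ≡⟨ cong (_/ N) (m*n/n≡m (m ℕ.* (P′ ℕ.* t)) p) ⟩
          m ℕ.* (P′ ℕ.* t) / N            ∎

    defect-primePower : ∀ t → defect (m ℕ.* p ^ suc a) t ≡ defect m (p ^ suc a ℕ.* t) - defect m (p ^ a ℕ.* t)
    defect-primePower t = begin
      + (N ℕ.* X) - + (t ℕ.* coprimeCount M M)                       ≡⟨ pos-difference (N ℕ.* X) (t ℕ.* coprimeCount M M) (N ℕ.* A ℕ.+ P′ ℕ.* t ℕ.* φm) (P ℕ.* t ℕ.* φm ℕ.+ N ℕ.* B) balance ⟩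
      + (N ℕ.* A ℕ.+ P′ ℕ.* t ℕ.* φm) - + (P ℕ.* t ℕ.* φm ℕ.+ N ℕ.* B) ≡⟨ cong₂ _-_ (ℤP.pos-+ (N ℕ.* A) _) (ℤP.pos-+ (P ℕ.* t ℕ.* φm) _) ⟩
      (+ (N ℕ.* A) ℤ.+ + (P′ ℕ.* t ℕ.* φm)) - (+ (P ℕ.* t ℕ.* φm) ℤ.+ + (N ℕ.* B)) ≡⟨ nested (+ (N ℕ.* A)) (+ (P ℕ.* t ℕ.* φm)) (+ (N ℕ.* B)) (+ (P′ ℕ.* t ℕ.* φm)) ⟨
      (+ (N ℕ.* A) - + (P ℕ.* t ℕ.* φm)) - (+ (N ℕ.* B) - + (P′ ℕ.* t ℕ.* φm)) ∎
      where
      X A B : ℕ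
      X = coprimeCount M (M ℕ.* t / N)
      A = coprimeCount m (m ℕ.* (P ℕ.* t) / N)
      B = coprimeCount m (m ℕ.* (P′ ℕ.* t) / N)
      nested : ∀ x y z w → (x - y) - (z - w) ≡ (x ℤ.+ w) - (y ℤ.+ z)
      nested = ℤSolver.solve-∀
      gather : ∀ n x b P t φ → n ℕ.* x ℕ.+ (P ℕ.* t ℕ.* φ ℕ.+ n ℕ.* b) ≡ n ℕ.* (x ℕ.+ b) ℕ.+ t ℕ.* (P ℕ.* φ)
      gather = ℕSolver.solve-∀
      scatter : ∀ n a t Φ P′ φ → n ℕ.* a ℕ.+ t ℕ.* (Φ ℕ.+ P′ ℕ.* φ) ≡ t ℕ.* Φ ℕ.+ (n ℕ.* a ℕ.+ P′ ℕ.* t ℕ.* φ)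
      scatter = ℕSolver.solve-∀
      balance : N ℕ.* X ℕ.+ (P ℕ.* t ℕ.* φm ℕ.+ N ℕ.* B) ≡ t ℕ.* coprimeCount M M ℕ.+ (N ℕ.* A ℕ.+ P′ ℕ.* t ℕ.* φm)
      balance = begin
        N ℕ.* X ℕ.+ (P ℕ.* t ℕ.* φm ℕ.+ N ℕ.* B)           ≡⟨ gather N X B P t φm ⟩
        N ℕ.* (X ℕ.+ B) ℕ.+ t ℕ.* (P ℕ.* φm)               ≡⟨ cong₂ (λ z w → N ℕ.* z ℕ.+ t ℕ.* w) (count-step t) (sym totient-step) ⟩
        N ℕ.* A ℕ.+ t ℕ.* (coprimeCount M M ℕ.+ P′ ℕ.* φm) ≡⟨ scatter N A t (coprimeCount M M) P′ φm ⟩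
        t ℕ.* coprimeCount M M ℕ.+ (N ℕ.* A ℕ.+ P′ ℕ.* t ℕ.* φm) ∎

  *-mod-cong : ∀ {x x′ y y′} → x % N ≡ x′ % N → y % N ≡ y′ % N → (x ℕ.* y) % N ≡ (x′ ℕ.* y′) % N
  *-mod-cong {x} {x′} {y} {y′} x≡ y≡ = begin
    (x ℕ.* y) % N               ≡⟨ %-distribˡ-* x y N ⟩
    ((x % N) ℕ.* (y % N)) % N   ≡⟨ cong₂ (λ u w → (u ℕ.* w) % N) x≡ y≡ ⟩
    ((x′ % N) ℕ.* (y′ % N)) % N ≡⟨ %-distribˡ-* x′ y′ N ⟨
    (x′ ℕ.* y′) % N             ∎

  RVec : Set
  RVec = Vec ℤ N

  infixl 9 _!_
  _!_ : RVec → ℕ → ℤ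
  v ! t = lookup v (t mod N)

  !-mod : ∀ v {x y} → x % N ≡ y % N → v ! x ≡ v ! y
  !-mod v {x} {y} eq = cong (lookup v) (fromℕ<-cong (x % N) (y % N) eq (m%n<n x N) (m%n<n y N))

  !-tabulate : ∀ (f : ℕ → ℤ) t → tabulate (f ∘ toℕ) ! t ≡ f (t % N)
  !-tabulate f t = trans (lookup∘tabulate (f ∘ toℕ) (t mod N)) (cong f (toℕ-fromℕ< (m%n<n t N)))

  RVec-ext : ∀ {v w} → (∀ t → v ! t ≡ w ! t) → v ≡ w
  RVec-ext {v} {w} v≗w = begin
    v                  ≡⟨ tabulate∘lookup v ⟨
    tabulate (lookup v) ≡⟨ tabulate-cong (λ i → trans (sym (!-toℕ v i)) (trans (v≗w (toℕ i)) (!-toℕ w i))) ⟩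
    tabulate (lookup w) ≡⟨ tabulate∘lookup w ⟩
    w                  ∎
    where
    !-toℕ : ∀ u i → u ! toℕ i ≡ lookup u i
    !-toℕ u i = cong (lookup u) (trans (fromℕ<-cong _ _ (m<n⇒m%n≡m (toℕ<n i)) (m%n<n (toℕ i) N) (toℕ<n i))
                                       (fromℕ<-toℕ i (toℕ<n i)))

  zeros : RVec
  zeros = replicate N (+ 0)

  zeros-! : ∀ t → zeros ! t ≡ + 0
  zeros-! t = lookup-replicate (t mod N) (+ 0)

  scale : ℤ → RVec → RVec
  scale k = map (k ℤ.*_)

  scale-! : ∀ k v t → scale k v ! t ≡ k ℤ.* v ! t
  scale-! k v t = lookup-map (t mod N) (k ℤ.*_) v

  scale-scale : ∀ k l v → scale k (scale l v) ≡ scale (k ℤ.* l) v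
  scale-scale k l v = RVec-ext λ t → begin
    scale k (scale l v) ! t  ≡⟨ scale-! k (scale l v) t ⟩
    k ℤ.* scale l v ! t      ≡⟨ cong (k ℤ.*_) (scale-! l v t) ⟩
    k ℤ.* (l ℤ.* v ! t)      ≡⟨ ℤP.*-assoc k l _ ⟨
    k ℤ.* l ℤ.* v ! t        ≡⟨ scale-! (k ℤ.* l) v t ⟨
    scale (k ℤ.* l) v ! t    ∎

  scale-one : ∀ v → scale (+ 1) v ≡ v
  scale-one v = RVec-ext λ t → trans (scale-! (+ 1) v t) (ℤP.*-identityˡ (v ! t))

  twist : ℕ → ℕ → RVec → RVec
  twist c d v = tabulate ((λ x → v ! (c ℕ.* x) - v ! (d ℕ.* x)) ∘ toℕ)

  twist-! : ∀ c d v t → twist c d v ! t ≡ v ! (c ℕ.* t) - v ! (d ℕ.* t)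
  twist-! c d v t = trans (!-tabulate (λ x → v ! (c ℕ.* x) - v ! (d ℕ.* x)) t) (cong₂ _-_ (!-mod v (reduce c)) (!-mod v (reduce d)))
    where
    reduce : ∀ c → (c ℕ.* (t % N)) % N ≡ (c ℕ.* t) % N
    reduce c = *-mod-cong {c} {c} refl (m%n%n≡m%n t N)

  twist-scale : ∀ c d k v → twist c d (scale k v) ≡ scale k (twist c d v)
  twist-scale c d k v = RVec-ext λ t → begin
    twist c d (scale k v) ! t                                ≡⟨ twist-! c d (scale k v) t ⟩
    scale k v ! (c ℕ.* t) - scale k v ! (d ℕ.* t)            ≡⟨ cong₂ _-_ (scale-! k v _) (scale-! k v _) ⟩
    k ℤ.* v ! (c ℕ.* t) - k ℤ.* v ! (d ℕ.* t)                ≡⟨ factor k _ _ ⟩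
    k ℤ.* (v ! (c ℕ.* t) - v ! (d ℕ.* t))                    ≡⟨ cong (k ℤ.*_) (twist-! c d v t) ⟨
    k ℤ.* twist c d v ! t                                    ≡⟨ scale-! k (twist c d v) t ⟨
    scale k (twist c d v) ! t                                ∎
    where
    factor : ∀ k x y → k ℤ.* x - k ℤ.* y ≡ k ℤ.* (x - y)
    factor = ℤSolver.solve-∀

  twist-cancel : ∀ c v → twist c c v ≡ zeros
  twist-cancel c v = RVec-ext λ t → trans (twist-! c c v t) (trans (ℤP.+-inverseʳ (v ! (c ℕ.* t))) (sym (zeros-! t)))

  twist-zeros : ∀ c d → twist c d zeros ≡ zeros
  twist-zeros c d = RVec-ext λ t → begin
    twist c d zeros ! t                            ≡⟨ twist-! c d zeros t ⟩
    zeros ! (c ℕ.* t) - zeros ! (d ℕ.* t)          ≡⟨ cong₂ _-_ (zeros-! _) (zeros-! _) ⟩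
    + 0                                            ≡⟨ zeros-! t ⟨
    zeros ! t                                      ∎

  twist-swap : ∀ c d v → twist d c v ≡ scale (- + 1) (twist c d v)
  twist-swap c d v = RVec-ext λ t → begin
    twist d c v ! t                                ≡⟨ twist-! d c v t ⟩
    v ! (d ℕ.* t) - v ! (c ℕ.* t)                  ≡⟨ flip (v ! (c ℕ.* t)) _ ⟩
    - + 1 ℤ.* (v ! (c ℕ.* t) - v ! (d ℕ.* t))      ≡⟨ cong (- + 1 ℤ.*_) (twist-! c d v t) ⟨
    - + 1 ℤ.* twist c d v ! t                      ≡⟨ scale-! (- + 1) (twist c d v) t ⟨
    scale (- + 1) (twist c d v) ! t                ∎
    where
    flip : ∀ x y → y - x ≡ - + 1 ℤ.* (x - y)
    flip = ℤSolver.solve-∀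

  twist-twist : ∀ c d c′ d′ v t → twist c d (twist c′ d′ v) ! t
    ≡ (v ! (c′ ℕ.* (c ℕ.* t)) - v ! (d′ ℕ.* (c ℕ.* t))) - (v ! (c′ ℕ.* (d ℕ.* t)) - v ! (d′ ℕ.* (d ℕ.* t)))
  twist-twist c d c′ d′ v t = trans (twist-! c d (twist c′ d′ v) t) (cong₂ _-_ (twist-! c′ d′ v (c ℕ.* t)) (twist-! c′ d′ v (d ℕ.* t)))

  twist-comm : ∀ c d c′ d′ v → twist c d (twist c′ d′ v) ≡ twist c′ d′ (twist c d v)
  twist-comm c d c′ d′ v = RVec-ext λ t → begin
    twist c d (twist c′ d′ v) ! t                  ≡⟨ twist-twist c d c′ d′ v t ⟩
    (v ! (c′ ℕ.* (c ℕ.* t)) - v ! (d′ ℕ.* (c ℕ.* t))) - (v ! (c′ ℕ.* (d ℕ.* t)) - v ! (d′ ℕ.* (d ℕ.* t)))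
      ≡⟨ cong₂ _-_ (cong₂ _-_ (swap c′ c t) (swap d′ c t)) (cong₂ _-_ (swap c′ d t) (swap d′ d t)) ⟩
    (v ! (c ℕ.* (c′ ℕ.* t)) - v ! (c ℕ.* (d′ ℕ.* t))) - (v ! (d ℕ.* (c′ ℕ.* t)) - v ! (d ℕ.* (d′ ℕ.* t)))
      ≡⟨ exchange (v ! (c ℕ.* (c′ ℕ.* t))) (v ! (c ℕ.* (d′ ℕ.* t))) (v ! (d ℕ.* (c′ ℕ.* t))) (v ! (d ℕ.* (d′ ℕ.* t))) ⟩
    (v ! (c ℕ.* (c′ ℕ.* t)) - v ! (d ℕ.* (c′ ℕ.* t))) - (v ! (c ℕ.* (d′ ℕ.* t)) - v ! (d ℕ.* (d′ ℕ.* t)))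
      ≡⟨ twist-twist c′ d′ c d v t ⟨
    twist c′ d′ (twist c d v) ! t                  ∎
    where
    swap : ∀ x y t → v ! (x ℕ.* (y ℕ.* t)) ≡ v ! (y ℕ.* (x ℕ.* t))
    swap x y t = cong (v !_) (trans (sym (ℕP.*-assoc x y t)) (trans (cong (ℕ._* t) (ℕP.*-comm x y)) (ℕP.*-assoc y x t)))
    exchange : ∀ a b e f → (a - b) - (e - f) ≡ (a - e) - (b - f)
    exchange = ℤSolver.solve-∀

  twist-square : ∀ c v → (c ℕ.* c) % N ≡ 1 % N → twist c 1 (twist c 1 v) ≡ scale (- + 2) (twist c 1 v)
  twist-square c v c²≡1 = RVec-ext λ t → begin
    twist c 1 (twist c 1 v) ! t                    ≡⟨ twist-twist c 1 c 1 v t ⟩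
    (v ! (c ℕ.* (c ℕ.* t)) - v ! (1 ℕ.* (c ℕ.* t))) - (v ! (c ℕ.* (1 ℕ.* t)) - v ! (1 ℕ.* (1 ℕ.* t)))
      ≡⟨ cong₂ _-_ (cong₂ _-_ (!-mod v (c²t≡t t)) (one (c ℕ.* t))) (cong₂ _-_ (cong (λ z → v ! (c ℕ.* z)) (ℕP.*-identityˡ t)) (trans (one (1 ℕ.* t)) (one t))) ⟩
    (v ! t - v ! (c ℕ.* t)) - (v ! (c ℕ.* t) - v ! t) ≡⟨ double (v ! t) (v ! (c ℕ.* t)) ⟩
    - + 2 ℤ.* (v ! (c ℕ.* t) - v ! t)              ≡⟨ cong (λ z → - + 2 ℤ.* (v ! (c ℕ.* t) - z)) (one t) ⟨
    - + 2 ℤ.* (v ! (c ℕ.* t) - v ! (1 ℕ.* t))      ≡⟨ cong (- + 2 ℤ.*_) (twist-! c 1 v t) ⟨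
    - + 2 ℤ.* twist c 1 v ! t                      ≡⟨ scale-! (- + 2) (twist c 1 v) t ⟨
    scale (- + 2) (twist c 1 v) ! t                ∎
    where
    one : ∀ x → v ! (1 ℕ.* x) ≡ v ! x
    one x = cong (v !_) (ℕP.*-identityˡ x)
    c²t≡t : ∀ t → (c ℕ.* (c ℕ.* t)) % N ≡ t % N
    c²t≡t t = trans (cong (_% N) (sym (ℕP.*-assoc c c t))) (trans (*-mod-cong c²≡1 refl) (cong (_% N) (ℕP.*-identityˡ t)))
    double : ∀ x y → (x - y) - (y - x) ≡ - + 2 ℤ.* (y - x)
    double = ℤSolver.solve-∀

  Represents : ℕ → RVec → Set
  Represents m v = ∀ t → defect m t ≡ v ! t

  ramp : RVec
  ramp = tabulate ((λ x → - + x) ∘ toℕ)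

  represents-1 : Represents 1 ramp
  represents-1 t = begin
    + (N ℕ.* coprimeCount 1 (1 ℕ.* t / N)) - + (t ℕ.* coprimeCount 1 1) ≡⟨ cong₂ (λ z w → + (N ℕ.* z) - + (t ℕ.* w)) (trans (coprimeCount-1 _) (cong (_/ N) (ℕP.*-identityˡ t))) (coprimeCount-1 1) ⟩
    + (N ℕ.* (t / N)) - + (t ℕ.* 1)                 ≡⟨ cong (λ z → + (N ℕ.* (t / N)) - + z) (trans (ℕP.*-identityʳ t) (m≡m%n+[m/n]*n t N)) ⟩
    + (N ℕ.* (t / N)) - + (t % N ℕ.+ t / N ℕ.* N)   ≡⟨ cong₂ _-_ (ℤP.pos-* N (t / N)) (trans (ℤP.pos-+ (t % N) _) (cong (ℤ._+_ (+ (t % N))) (ℤP.pos-* (t / N) N))) ⟩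
    + N ℤ.* + (t / N) - (+ (t % N) ℤ.+ + (t / N) ℤ.* + N) ≡⟨ leaveRemainder (+ N) (+ (t / N)) (+ (t % N)) ⟩
    - + (t % N)                                     ≡⟨ !-tabulate (λ x → - + x) t ⟨
    ramp ! t                                        ∎
    where
    leaveRemainder : ∀ n q r → n ℤ.* q - (r ℤ.+ q ℤ.* n) ≡ - r
    leaveRemainder = ℤSolver.solve-∀

  represents-twist : ∀ {p m c d v} a → Prime p → ¬ p ∣ m → p ^ suc a % N ≡ c % N → p ^ a % N ≡ d % N →
    Represents m v → Represents (m ℕ.* p ^ suc a) (twist c d v)
  represents-twist {p} {m} {c} {d} {v} a p-prime p∤m P≡c P′≡d rep t = begin
    defect (m ℕ.* p ^ suc a) t                                   ≡⟨ defect-primePower a p-prime p∤m t ⟩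
    defect m (p ^ suc a ℕ.* t) - defect m (p ^ a ℕ.* t)         ≡⟨ cong₂ _-_ (rep _) (rep _) ⟩
    v ! (p ^ suc a ℕ.* t) - v ! (p ^ a ℕ.* t)                   ≡⟨ cong₂ _-_ (!-mod v (*-mod-cong P≡c refl)) (!-mod v (*-mod-cong P′≡d refl)) ⟩
    v ! (c ℕ.* t) - v ! (d ℕ.* t)                               ≡⟨ twist-! c d v t ⟨
    twist c d v ! t                                              ∎

  ^-mod-pattern : ∀ x (f : ℕ → ℕ) → f 0 ≡ 1 → (∀ b → (x ℕ.* f b) % N ≡ f (suc b) % N) → ∀ b → x ^ b % N ≡ f b % N
  ^-mod-pattern x f f0≡1 step zero = cong (_% N) (sym f0≡1)
  ^-mod-pattern x f f0≡1 step (suc b) = trans (*-mod-cong {x} {x} refl (^-mod-pattern x f f0≡1 step b)) (step b)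

module Representation where

  open import Defs using (prodPow)
  open Primes
  open Defect 12 public
  open import Data.Nat
  open import Data.Nat.Properties
  open import Data.Nat.DivMod using (m%n%n≡m%n)
  open import Data.Nat.Divisibility using (_∣_)
  open import Data.Nat.Primality using (Prime; prime[2]; euclidsLemma)
  open import Data.Fin using (Fin) renaming (zero to fzero; suc to fsuc)
  import Data.Fin.Properties as Fin
  open import Data.Product using (_,_)
  open import Data.Sum using (inj₁; inj₂)
  open import Function using (_∘_)
  open import Relation.Nullary using (¬_)
  open import Relation.Binary.PropositionalEquality

  pow2Mod12 : ℕ → ℕ
  pow2Mod12 0 = 1
  pow2Mod12 1 = 2
  pow2Mod12 2 = 4
  pow2Mod12 3 = 8
  pow2Mod12 (suc (suc (suc (suc b)))) = pow2Mod12 (suc (suc b))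

  pow3Mod12 : ℕ → ℕ
  pow3Mod12 0 = 1
  pow3Mod12 1 = 3
  pow3Mod12 2 = 9
  pow3Mod12 (suc (suc (suc b))) = pow3Mod12 (suc b)

  powParity : ℕ → ℕ → ℕ
  powParity u 0 = 1
  powParity u 1 = u
  powParity u (suc (suc b)) = powParity u b

  2^-mod12 : ∀ b → 2 ^ b % 12 ≡ pow2Mod12 b % 12
  2^-mod12 = ^-mod-pattern 2 pow2Mod12 refl step
    where
    step : ∀ b → (2 * pow2Mod12 b) % 12 ≡ pow2Mod12 (suc b) % 12
    step 0 = refl
    step 1 = refl
    step 2 = refl
    step 3 = refl
    step (suc (suc (suc (suc b)))) = step (suc (suc b))

  3^-mod12 : ∀ b → 3 ^ b % 12 ≡ pow3Mod12 b % 12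
  3^-mod12 = ^-mod-pattern 3 pow3Mod12 refl step
    where
    step : ∀ b → (3 * pow3Mod12 b) % 12 ≡ pow3Mod12 (suc b) % 12
    step 0 = refl
    step 1 = refl
    step 2 = refl
    step (suc (suc (suc b))) = step (suc b)

  ^-mod12-powParity : ∀ x → (x * x) % 12 ≡ 1 → ∀ b → x ^ b % 12 ≡ powParity (x % 12) b % 12
  ^-mod12-powParity x x²≡1 = ^-mod-pattern x (powParity (x % 12)) refl step
    where
    step : ∀ b → (x * powParity (x % 12) b) % 12 ≡ powParity (x % 12) (suc b) % 12
    step 0 = trans (cong (_% 12) (*-identityʳ x)) (sym (m%n%n≡m%n x 12))
    step 1 = trans (*-mod-cong {x} {x} refl (m%n%n≡m%n x 12)) x²≡1
    step (suc (suc b)) = step b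

  twist2 : ℕ → RVec → RVec
  twist2 zero v = v
  twist2 (suc a) v = twist (pow2Mod12 (suc a)) (pow2Mod12 a) v

  twist3 : ℕ → RVec → RVec
  twist3 zero v = v
  twist3 (suc b) v = twist (pow3Mod12 (suc b)) (pow3Mod12 b) v

  base : ℕ → ℕ → RVec
  base α β = twist3 β (twist2 α ramp)

  represents-2^ : ∀ α → Represents (2 ^ α) (twist2 α ramp)
  represents-2^ zero = represents-1
  represents-2^ (suc a) t = trans (cong (λ z → defect z t) (sym (*-identityˡ (2 ^ suc a))))
    (represents-twist {c = pow2Mod12 (suc a)} {d = pow2Mod12 a} {v = ramp} a prime[2] (prime∤1 prime[2]) (2^-mod12 (suc a)) (2^-mod12 a) represents-1 t)

  represents-base : ∀ α β → Represents (2 ^ α * 3 ^ β) (base α β)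
  represents-base α zero t = trans (cong (λ z → defect z t) (*-identityʳ (2 ^ α))) (represents-2^ α t)
  represents-base α (suc b) = represents-twist {c = pow3Mod12 (suc b)} {d = pow3Mod12 b} {v = twist2 α ramp} b prime[3] (λ 3∣2^α → 3≢2 (prime∣^⇒≡ α prime[3] prime[2] 3∣2^α))
    (3^-mod12 (suc b)) (3^-mod12 b) (represents-2^ α)
    where
    3≢2 : 3 ≢ 2
    3≢2 ()

  run : ∀ {k} → (Fin k → ℕ) → (Fin k → ℕ) → RVec → RVec
  run {zero} r e v = v
  run {suc k} r e v = twist (powParity (r fzero) (suc (e fzero))) (powParity (r fzero) (e fzero)) (run (r ∘ fsuc) (e ∘ fsuc) v)

  represents-run : ∀ {k m v} (p e : Fin k → ℕ) → (∀ i j → p i ≡ p j → i ≡ j) → (∀ i → Prime (p i)) →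
    (∀ i → (p i * p i) % 12 ≡ 1) → (∀ i → ¬ p i ∣ m) → Represents m v →
    Represents (m * prodPow p (suc ∘ e)) (run (λ i → p i % 12) e v)
  represents-run {zero} {m} p e _ _ _ _ rep t = trans (cong (λ z → defect z t) (*-identityʳ m)) (rep t)
  represents-run {suc k} {m} {v} p e p-inj p-prime p²≡1 p∤m rep t =
    trans (cong (λ z → defect z t) regroup)
      (represents-twist {c = powParity (p fzero % 12) (suc (e fzero))} {d = powParity (p fzero % 12) (e fzero)}
        {v = run (λ i → p (fsuc i) % 12) (e ∘ fsuc) v} (e fzero) (p-prime fzero) p∤rest
        (^-mod12-powParity (p fzero) (p²≡1 fzero) (suc (e fzero)))
        (^-mod12-powParity (p fzero) (p²≡1 fzero) (e fzero))
        (represents-run (p ∘ fsuc) (e ∘ fsuc) (λ i j eq → Fin.suc-injective (p-inj (fsuc i) (fsuc j) eq))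
          (p-prime ∘ fsuc) (p²≡1 ∘ fsuc) (p∤m ∘ fsuc) rep) t)
    where
    rest = prodPow (p ∘ fsuc) (suc ∘ e ∘ fsuc)
    regroup : m * (p fzero ^ suc (e fzero) * rest) ≡ m * rest * p fzero ^ suc (e fzero)
    regroup = trans (cong (m *_) (*-comm (p fzero ^ suc (e fzero)) rest)) (sym (*-assoc m rest _))
    p∤rest : ¬ p fzero ∣ m * rest
    p∤rest p∣ with euclidsLemma m rest (p-prime fzero) p∣
    ... | inj₁ p∣m = p∤m fzero p∣m
    ... | inj₂ p∣rest with prime∣prodPow (p ∘ fsuc) (suc ∘ e ∘ fsuc) (p-prime fzero) (p-prime ∘ fsuc) p∣rest
    ...   | i , p₀≡pᵢ with p-inj fzero (fsuc i) p₀≡pᵢ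
    ...     | ()

module NormalForm where

  open Representation
  open import Data.Nat as ℕ using (ℕ; zero; suc; _≡ᵇ_)
  import Data.Nat.Properties as ℕP
  open import Data.Nat.ListAction using (sum)
  open import Data.Integer as ℤ using (ℤ; +_; -_)
  import Data.Integer.Properties as ℤP
  import Data.Integer.Tactic.RingSolver as ℤSolver
  import Data.Nat.Tactic.RingSolver as ℕSolver
  open import Data.Bool using (Bool; true; false; _∨_)
  open import Data.Fin using (Fin) renaming (zero to fzero; suc to fsuc)
  open import Data.List using (tabulate)
  open import Data.Product using (∃; _,_)
  open import Function using (_∘_)
  open import Relation.Binary.PropositionalEquality
  open ≡-Reasoning

  sgnℤ : ℕ → ℤ
  sgnℤ 0 = + 1
  sgnℤ 1 = - + 1
  sgnℤ (suc (suc m)) = sgnℤ m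

  sgnℤ-suc : ∀ m → sgnℤ (suc m) ≡ - + 1 ℤ.* sgnℤ m
  sgnℤ-suc 0 = refl
  sgnℤ-suc 1 = refl
  sgnℤ-suc (suc (suc m)) = sgnℤ-suc m

  sgnℤ-+ : ∀ m n → sgnℤ (m ℕ.+ n) ≡ sgnℤ m ℤ.* sgnℤ n
  sgnℤ-+ 0 n = sym (ℤP.*-identityˡ (sgnℤ n))
  sgnℤ-+ 1 n = sgnℤ-suc n
  sgnℤ-+ (suc (suc m)) n = sgnℤ-+ m n

  -2^≡sgnℤ : ∀ m → (- + 2) ℤ.^ m ≡ sgnℤ m ℤ.* + (2 ℕ.^ m)
  -2^≡sgnℤ zero = refl
  -2^≡sgnℤ (suc m) = begin
    - + 2 ℤ.* (- + 2) ℤ.^ m                   ≡⟨ cong (- + 2 ℤ.*_) (-2^≡sgnℤ m) ⟩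
    - + 2 ℤ.* (sgnℤ m ℤ.* + (2 ℕ.^ m))      ≡⟨ split (sgnℤ m) (+ (2 ℕ.^ m)) ⟩
    - + 1 ℤ.* sgnℤ m ℤ.* (+ 2 ℤ.* + (2 ℕ.^ m)) ≡⟨ cong₂ ℤ._*_ (sgnℤ-suc m) (ℤP.pos-* 2 (2 ℕ.^ m)) ⟨
    sgnℤ (suc m) ℤ.* + (2 ℕ.^ suc m)        ∎
    where
    split : ∀ s P → - + 2 ℤ.* (s ℤ.* P) ≡ - + 1 ℤ.* s ℤ.* (+ 2 ℤ.* P)
    split = ℤSolver.solve-∀

  twist-powParity : ∀ u e w → twist (powParity u (suc e)) (powParity u e) w ≡ scale (sgnℤ e) (twist u 1 w)
  twist-powParity u 0 w = sym (scale-one (twist u 1 w))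
  twist-powParity u 1 w = twist-swap u 1 w
  twist-powParity u (suc (suc e)) w = twist-powParity u e w

  twistIf : Bool → ℕ → RVec → RVec
  twistIf true c v = twist c 1 v
  twistIf false c v = v

  normalForm : RVec → Bool → Bool → Bool → RVec
  normalForm v h5 h7 h11 = twistIf h5 5 (twistIf h7 7 (twistIf h11 11 v))

  doubling : Bool → ℤ
  doubling true = - + 2
  doubling false = + 1

  twistIf-scale : ∀ h c k v → twistIf h c (scale k v) ≡ scale k (twistIf h c v)
  twistIf-scale true c k v = twist-scale c 1 k v
  twistIf-scale false c k v = refl

  twist-twistIf : ∀ h c d v → twist c 1 (twistIf h d v) ≡ twistIf h d (twist c 1 v)
  twist-twistIf true c d v = twist-comm c 1 d 1 v
  twist-twistIf false c d v = refl

  twist-absorb : ∀ h c v → (c ℕ.* c) ℕ.% 12 ≡ 1 → twist c 1 (twistIf h c v) ≡ scale (doubling h) (twist c 1 v)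
  twist-absorb true c v c²≡1 = twist-square c v c²≡1
  twist-absorb false c v _ = sym (scale-one (twist c 1 v))

  twist5-normalForm : ∀ v h5 h7 h11 → twist 5 1 (normalForm v h5 h7 h11) ≡ scale (doubling h5) (normalForm v true h7 h11)
  twist5-normalForm v h5 h7 h11 = twist-absorb h5 5 _ refl

  twist7-normalForm : ∀ v h5 h7 h11 → twist 7 1 (normalForm v h5 h7 h11) ≡ scale (doubling h7) (normalForm v h5 true h11)
  twist7-normalForm v h5 h7 h11 = begin
    twist 7 1 (twistIf h5 5 (twistIf h7 7 w))                 ≡⟨ twist-twistIf h5 7 5 _ ⟩
    twistIf h5 5 (twist 7 1 (twistIf h7 7 w))                 ≡⟨ cong (twistIf h5 5) (twist-absorb h7 7 w refl) ⟩
    twistIf h5 5 (scale (doubling h7) (twist 7 1 w))          ≡⟨ twistIf-scale h5 5 (doubling h7) _ ⟩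
    scale (doubling h7) (normalForm v h5 true h11)            ∎
    where w = twistIf h11 11 v

  twist11-normalForm : ∀ v h5 h7 h11 → twist 11 1 (normalForm v h5 h7 h11) ≡ scale (doubling h11) (normalForm v h5 h7 true)
  twist11-normalForm v h5 h7 h11 = begin
    twist 11 1 (twistIf h5 5 (twistIf h7 7 (twistIf h11 11 v))) ≡⟨ twist-twistIf h5 11 5 _ ⟩
    twistIf h5 5 (twist 11 1 (twistIf h7 7 (twistIf h11 11 v))) ≡⟨ cong (twistIf h5 5) (twist-twistIf h7 11 7 _) ⟩
    twistIf h5 5 (twistIf h7 7 (twist 11 1 (twistIf h11 11 v))) ≡⟨ cong (twistIf h5 5 ∘ twistIf h7 7) (twist-absorb h11 11 v refl) ⟩
    twistIf h5 5 (twistIf h7 7 (scale (doubling h11) (twist 11 1 v))) ≡⟨ cong (twistIf h5 5) (twistIf-scale h7 7 (doubling h11) _) ⟩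
    twistIf h5 5 (scale (doubling h11) (twistIf h7 7 (twist 11 1 v))) ≡⟨ twistIf-scale h5 5 (doubling h11) _ ⟩
    scale (doubling h11) (normalForm v h5 h7 true)              ∎

  data NonTrivialUnit : ℕ → Set where
    five : NonTrivialUnit 5
    seven : NonTrivialUnit 7
    eleven : NonTrivialUnit 11

  occurs : ℕ → ∀ {k} → (Fin k → ℕ) → Bool
  occurs u {zero} r = false
  occurs u {suc k} r = (r fzero ≡ᵇ u) ∨ occurs u (r ∘ fsuc)

  coefficient : ∀ {k} → (Fin k → ℕ) → (Fin k → ℕ) → ℤ
  coefficient {zero} r e = + 1
  coefficient {suc k} r e = sgnℤ (e fzero) ℤ.* doubling (occurs (r fzero) (r ∘ fsuc)) ℤ.* coefficient (r ∘ fsuc) (e ∘ fsuc)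

  run-normalForm : ∀ {k} (r e : Fin k → ℕ) v → (∀ i → NonTrivialUnit (r i)) →
    run r e v ≡ scale (coefficient r e) (normalForm v (occurs 5 r) (occurs 7 r) (occurs 11 r))
  run-normalForm {zero} r e v _ = sym (scale-one v)
  run-normalForm {suc k} r e v units = begin
    twist (powParity u (suc e₀)) (powParity u e₀) (run r′ e′ v)
      ≡⟨ cong (twist (powParity u (suc e₀)) (powParity u e₀)) (run-normalForm r′ e′ v (units ∘ fsuc)) ⟩
    twist (powParity u (suc e₀)) (powParity u e₀) (scale c′ (normalForm v h5 h7 h11))
      ≡⟨ twist-scale (powParity u (suc e₀)) (powParity u e₀) c′ (normalForm v h5 h7 h11) ⟩
    scale c′ (twist (powParity u (suc e₀)) (powParity u e₀) (normalForm v h5 h7 h11))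
      ≡⟨ cong (scale c′) (twist-powParity u e₀ (normalForm v h5 h7 h11)) ⟩
    scale c′ (scale (sgnℤ e₀) (twist u 1 (normalForm v h5 h7 h11)))
      ≡⟨ cong (scale c′ ∘ scale (sgnℤ e₀)) (twistUnit (units fzero)) ⟩
    scale c′ (scale (sgnℤ e₀) (scale (doubling (occurs u r′)) (normalForm v (occurs 5 r) (occurs 7 r) (occurs 11 r))))
      ≡⟨ trans (cong (scale c′) (scale-scale (sgnℤ e₀) (doubling (occurs u r′)) nf)) (scale-scale c′ _ nf) ⟩
    scale (c′ ℤ.* (sgnℤ e₀ ℤ.* doubling (occurs u r′))) (normalForm v (occurs 5 r) (occurs 7 r) (occurs 11 r))
      ≡⟨ cong (λ z → scale z nf) (ℤP.*-comm c′ (sgnℤ e₀ ℤ.* doubling (occurs u r′))) ⟩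
    scale (coefficient r e) (normalForm v (occurs 5 r) (occurs 7 r) (occurs 11 r)) ∎
    where
    u = r fzero
    e₀ = e fzero
    r′ = r ∘ fsuc
    e′ = e ∘ fsuc
    c′ = coefficient r′ e′
    h5 = occurs 5 r′
    h7 = occurs 7 r′
    h11 = occurs 11 r′
    nf = normalForm v (occurs 5 r) (occurs 7 r) (occurs 11 r)
    twistUnit : NonTrivialUnit u → twist u 1 (normalForm v h5 h7 h11)
      ≡ scale (doubling (occurs u r′)) (normalForm v (occurs 5 r) (occurs 7 r) (occurs 11 r))
    twistUnit unit with u | unit
    ... | .5 | five = twist5-normalForm v h5 h7 h11
    ... | .7 | seven = twist7-normalForm v h5 h7 h11
    ... | .11 | eleven = twist11-normalForm v h5 h7 h11

  powParity-1 : ∀ b → powParity 1 b ≡ 1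
  powParity-1 0 = refl
  powParity-1 1 = refl
  powParity-1 (suc (suc b)) = powParity-1 b

  run-zeros : ∀ {k} (r e : Fin k → ℕ) v → ∃ (λ i → r i ≡ 1) → run r e v ≡ zeros
  run-zeros {suc k} r e v (fzero , r₀≡1) = begin
    twist (powParity (r fzero) (suc (e fzero))) (powParity (r fzero) (e fzero)) w
      ≡⟨ cong₂ (λ c d → twist c d w) (unit-power (suc (e fzero))) (unit-power (e fzero)) ⟩
    twist 1 1 w ≡⟨ twist-cancel 1 w ⟩
    zeros       ∎
    where
    w = run (r ∘ fsuc) (e ∘ fsuc) v
    unit-power : ∀ b → powParity (r fzero) b ≡ 1
    unit-power b = trans (cong (λ u → powParity u b) r₀≡1) (powParity-1 b)
  run-zeros {suc k} r e v (fsuc i , rᵢ≡1) =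
    trans (cong (twist (powParity (r fzero) (suc (e fzero))) (powParity (r fzero) (e fzero))) (run-zeros (r ∘ fsuc) (e ∘ fsuc) v (i , rᵢ≡1)))
          (twist-zeros (powParity (r fzero) (suc (e fzero))) (powParity (r fzero) (e fzero)))

  fromBool : Bool → ℕ
  fromBool true = 1
  fromBool false = 0

  flagCount : Bool → Bool → Bool → ℕ
  flagCount h5 h7 h11 = fromBool h5 ℕ.+ (fromBool h7 ℕ.+ fromBool h11)

  distinctUnits : ∀ {k} → (Fin k → ℕ) → ℕ
  distinctUnits r = flagCount (occurs 5 r) (occurs 7 r) (occurs 11 r)

  absorb5 : ∀ h5 h7 h11 → doubling h5 ℤ.* (- + 2) ℤ.^ flagCount true h7 h11 ≡ - + 2 ℤ.* (- + 2) ℤ.^ flagCount h5 h7 h11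
  absorb5 true h7 h11 = refl
  absorb5 false h7 h11 = ℤP.*-identityˡ _

  absorb7 : ∀ h5 h7 h11 → doubling h7 ℤ.* (- + 2) ℤ.^ flagCount h5 true h11 ≡ - + 2 ℤ.* (- + 2) ℤ.^ flagCount h5 h7 h11
  absorb7 h5 true h11 = refl
  absorb7 true false h11 = ℤP.*-identityˡ _
  absorb7 false false h11 = ℤP.*-identityˡ _

  absorb11 : ∀ h5 h7 h11 → doubling h11 ℤ.* (- + 2) ℤ.^ flagCount h5 h7 true ≡ - + 2 ℤ.* (- + 2) ℤ.^ flagCount h5 h7 h11
  absorb11 h5 h7 true = refl
  absorb11 true true false = ℤP.*-identityˡ _
  absorb11 true false false = ℤP.*-identityˡ _
  absorb11 false true false = ℤP.*-identityˡ _
  absorb11 false false false = ℤP.*-identityˡ _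

  coefficient-distinctUnits : ∀ {k} (r e : Fin k → ℕ) → (∀ i → NonTrivialUnit (r i)) →
    coefficient r e ℤ.* (- + 2) ℤ.^ distinctUnits r ≡ sgnℤ (sum (tabulate e)) ℤ.* (- + 2) ℤ.^ k
  coefficient-distinctUnits {zero} r e _ = refl
  coefficient-distinctUnits {suc k} r e units = begin
    sgnℤ e₀ ℤ.* doubling (occurs u r′) ℤ.* c′ ℤ.* (- + 2) ℤ.^ distinctUnits r
      ≡⟨ regroup (sgnℤ e₀) (doubling (occurs u r′)) c′ _ ⟩
    sgnℤ e₀ ℤ.* c′ ℤ.* (doubling (occurs u r′) ℤ.* (- + 2) ℤ.^ distinctUnits r)
      ≡⟨ cong (sgnℤ e₀ ℤ.* c′ ℤ.*_) (absorb (units fzero)) ⟩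
    sgnℤ e₀ ℤ.* c′ ℤ.* (- + 2 ℤ.* (- + 2) ℤ.^ distinctUnits r′)
      ≡⟨ regroup′ (sgnℤ e₀) c′ (- + 2) _ ⟩
    sgnℤ e₀ ℤ.* - + 2 ℤ.* (c′ ℤ.* (- + 2) ℤ.^ distinctUnits r′)
      ≡⟨ cong (sgnℤ e₀ ℤ.* - + 2 ℤ.*_) (coefficient-distinctUnits r′ e′ (units ∘ fsuc)) ⟩
    sgnℤ e₀ ℤ.* - + 2 ℤ.* (sgnℤ (sum (tabulate e′)) ℤ.* (- + 2) ℤ.^ k)
      ≡⟨ regroup′ (sgnℤ e₀) (- + 2) (sgnℤ (sum (tabulate e′))) _ ⟩
    sgnℤ e₀ ℤ.* sgnℤ (sum (tabulate e′)) ℤ.* (- + 2 ℤ.* (- + 2) ℤ.^ k)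
      ≡⟨ cong (ℤ._* (- + 2) ℤ.^ suc k) (sgnℤ-+ e₀ _) ⟨
    sgnℤ (sum (tabulate e)) ℤ.* (- + 2) ℤ.^ suc k ∎
    where
    u = r fzero
    e₀ = e fzero
    r′ = r ∘ fsuc
    e′ = e ∘ fsuc
    c′ = coefficient r′ e′
    regroup : ∀ s b c P → s ℤ.* b ℤ.* c ℤ.* P ≡ s ℤ.* c ℤ.* (b ℤ.* P)
    regroup = ℤSolver.solve-∀
    regroup′ : ∀ s c b P → s ℤ.* c ℤ.* (b ℤ.* P) ≡ s ℤ.* b ℤ.* (c ℤ.* P)
    regroup′ = ℤSolver.solve-∀
    absorb : NonTrivialUnit u → doubling (occurs u r′) ℤ.* (- + 2) ℤ.^ distinctUnits r ≡ - + 2 ℤ.* (- + 2) ℤ.^ distinctUnits r′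
    absorb unit with u | unit
    ... | .5 | five = absorb5 (occurs 5 r′) (occurs 7 r′) (occurs 11 r′)
    ... | .7 | seven = absorb7 (occurs 5 r′) (occurs 7 r′) (occurs 11 r′)
    ... | .11 | eleven = absorb11 (occurs 5 r′) (occurs 7 r′) (occurs 11 r′)

  sgnℤ-collect : ∀ a b m K d → sgnℤ a ℤ.* (sgnℤ b ℤ.* (- + 2) ℤ.^ m) ℤ.* + (K ℕ.* 2 ℕ.^ d)
    ≡ sgnℤ (a ℕ.+ b ℕ.+ m) ℤ.* + (K ℕ.* 2 ℕ.^ (m ℕ.+ d))
  sgnℤ-collect a b m K d = begin
    sgnℤ a ℤ.* (sgnℤ b ℤ.* (- + 2) ℤ.^ m) ℤ.* + (K ℕ.* 2 ℕ.^ d)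
      ≡⟨ cong (λ z → sgnℤ a ℤ.* (sgnℤ b ℤ.* z) ℤ.* + (K ℕ.* 2 ℕ.^ d)) (-2^≡sgnℤ m) ⟩
    sgnℤ a ℤ.* (sgnℤ b ℤ.* (sgnℤ m ℤ.* + (2 ℕ.^ m))) ℤ.* + (K ℕ.* 2 ℕ.^ d)
      ≡⟨ regroup (sgnℤ a) (sgnℤ b) (sgnℤ m) (+ (2 ℕ.^ m)) (+ (K ℕ.* 2 ℕ.^ d)) ⟩
    sgnℤ a ℤ.* sgnℤ b ℤ.* sgnℤ m ℤ.* (+ (2 ℕ.^ m) ℤ.* + (K ℕ.* 2 ℕ.^ d))
      ≡⟨ cong₂ ℤ._*_ signs (trans (sym (ℤP.pos-* (2 ℕ.^ m) _)) (cong +_ powers)) ⟩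
    sgnℤ (a ℕ.+ b ℕ.+ m) ℤ.* + (K ℕ.* 2 ℕ.^ (m ℕ.+ d)) ∎
    where
    regroup : ∀ x y z P Q → x ℤ.* (y ℤ.* (z ℤ.* P)) ℤ.* Q ≡ x ℤ.* y ℤ.* z ℤ.* (P ℤ.* Q)
    regroup = ℤSolver.solve-∀
    signs : sgnℤ a ℤ.* sgnℤ b ℤ.* sgnℤ m ≡ sgnℤ (a ℕ.+ b ℕ.+ m)
    signs = sym (trans (sgnℤ-+ (a ℕ.+ b) m) (cong (ℤ._* sgnℤ m) (sgnℤ-+ a b)))
    powers : 2 ℕ.^ m ℕ.* (K ℕ.* 2 ℕ.^ d) ≡ K ℕ.* 2 ℕ.^ (m ℕ.+ d)
    powers = trans (exchange (2 ℕ.^ m) K (2 ℕ.^ d)) (cong (K ℕ.*_) (sym (ℕP.^-distribˡ-+-* 2 m d)))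
      where
      exchange : ∀ x y z → x ℕ.* (y ℕ.* z) ≡ y ℕ.* (x ℕ.* z)
      exchange = ℕSolver.solve-∀

module PrimeFactors where

  open import Defs using (oneTo; prodPow; Ω; ω)
  open Counting using (indicator; indicator-yes; indicator-no; countTo; countTo-suc; oneTo-suc)
  open Primes using (prime∣^⇒≡; prime∤1)
  open import Data.Nat
  open import Data.Nat.Properties
  open import Data.Nat.Divisibility
  open import Data.Nat.Primality using (Prime; prime?; prime[2]; euclidsLemma; prime⇒nonZero; prime⇒nonTrivial)
  open import Data.Nat.ListAction using (sum)
  open import Data.Nat.ListAction.Properties using (sum-++)
  open import Data.List using (List; []; _∷_; length; filter; map; concatMap; tabulate; [_])
  open import Data.List.Properties using (map-++; length-++; filter-++; map-tabulate; filter-≐; filter-none)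
  open import Data.List.Membership.Propositional using (_∈_)
  open import Data.List.Membership.Propositional.Properties using (∈-tabulate⁺)
  open import Data.List.Relation.Unary.Any using (here; there)
  import Data.List.Relation.Unary.All as All
  open import Data.List.Relation.Unary.AllPairs using (_∷_)
  open import Data.List.Relation.Unary.Unique.Propositional using (Unique)
  open import Data.List.Relation.Unary.Unique.Propositional.Properties using (tabulate⁺)
  open import Data.Fin using (Fin) renaming (zero to fzero; suc to fsuc)
  import Data.Fin.Properties as Fin
  open import Data.Product using (_×_; _,_; proj₁; proj₂; ∃)
  open import Data.Sum using (inj₁; inj₂)
  open import Function using (_∘_)
  open import Relation.Nullary using (Dec; yes; no; ¬_; contradiction)
  open import Relation.Nullary.Decidable using (_×-dec_)
  open import Relation.Unary using (Decidable)
  open import Relation.Binary.PropositionalEquality hiding ([_])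

  length-filter≡sum : ∀ {A : Set} {P : A → Set} (P? : Decidable P) xs →
    length (filter P? xs) ≡ sum (map (indicator ∘ P?) xs)
  length-filter≡sum P? [] = refl
  length-filter≡sum P? (x ∷ xs) with P? x
  ... | yes _ = cong suc (length-filter≡sum P? xs)
  ... | no _ = length-filter≡sum P? xs

  length-filter-concatMap : ∀ {A B : Set} {P : B → Set} (P? : Decidable P) (f : A → List B) xs →
    length (filter P? (concatMap f xs)) ≡ sum (map (λ x → length (filter P? (f x))) xs)
  length-filter-concatMap P? f [] = refl
  length-filter-concatMap P? f (x ∷ xs) = begin
    length (filter P? (f x Data.List.++ concatMap f xs))                   ≡⟨ cong length (filter-++ P? (f x) _) ⟩
    length (filter P? (f x) Data.List.++ filter P? (concatMap f xs))       ≡⟨ length-++ (filter P? (f x)) ⟩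
    length (filter P? (f x)) + length (filter P? (concatMap f xs))        ≡⟨ cong (length (filter P? (f x)) +_) (length-filter-concatMap P? f xs) ⟩
    length (filter P? (f x)) + sum (map (λ y → length (filter P? (f y))) xs) ∎
    where open ≡-Reasoning

  length-filter-map : ∀ {A B : Set} {P : B → Set} (P? : Decidable P) (g : A → B) ys →
    length (filter P? (map g ys)) ≡ length (filter (P? ∘ g) ys)
  length-filter-map P? g [] = refl
  length-filter-map P? g (y ∷ ys) with P? (g y)
  ... | yes _ = cong suc (length-filter-map P? g ys)
  ... | no _ = length-filter-map P? g ys

  sum-map-cong : ∀ {g g′ : ℕ → ℕ} (L : List ℕ) → (∀ j → j ∈ L → g j ≡ g′ j) → sum (map g L) ≡ sum (map g′ L)
  sum-map-cong [] _ = refl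
  sum-map-cong (a ∷ L) g≗g′ = cong₂ _+_ (g≗g′ a (here refl)) (sum-map-cong L (λ j j∈L → g≗g′ j (there j∈L)))

  sum-tabulate-cong : ∀ {k} {f g : Fin k → ℕ} → (∀ i → f i ≡ g i) → sum (tabulate f) ≡ sum (tabulate g)
  sum-tabulate-cong {zero} _ = refl
  sum-tabulate-cong {suc k} f≗g = cong₂ _+_ (f≗g fzero) (sum-tabulate-cong (f≗g ∘ fsuc))

  sumTo : (ℕ → ℕ) → ℕ → ℕ
  sumTo g x = sum (map g (oneTo x))

  sumTo-suc : ∀ g x → sumTo g (suc x) ≡ sumTo g x + g (suc x)
  sumTo-suc g x = begin
    sum (map g (oneTo (suc x)))                 ≡⟨ cong (sum ∘ map g) (oneTo-suc x) ⟩
    sum (map g (oneTo x Data.List.++ [ suc x ])) ≡⟨ cong sum (map-++ g (oneTo x) [ suc x ]) ⟩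
    sum (map g (oneTo x) Data.List.++ [ g (suc x) ]) ≡⟨ sum-++ (map g (oneTo x)) [ g (suc x) ] ⟩
    sumTo g x + (g (suc x) + 0)                 ≡⟨ cong (sumTo g x +_) (+-identityʳ (g (suc x))) ⟩
    sumTo g x + g (suc x)                       ∎
    where open ≡-Reasoning

  sumTo-cong : ∀ {g g′} x → (∀ j → 1 ≤ j → j ≤ x → g j ≡ g′ j) → sumTo g x ≡ sumTo g′ x
  sumTo-cong zero _ = refl
  sumTo-cong {g} {g′} (suc x) g≗g′ = begin
    sumTo g (suc x)          ≡⟨ sumTo-suc g x ⟩
    sumTo g x + g (suc x)    ≡⟨ cong₂ _+_ (sumTo-cong x (λ j 1≤j j≤x → g≗g′ j 1≤j (m≤n⇒m≤1+n j≤x))) (g≗g′ (suc x) (s≤s z≤n) ≤-refl) ⟩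
    sumTo g′ x + g′ (suc x)  ≡⟨ sumTo-suc g′ x ⟨
    sumTo g′ (suc x)         ∎
    where open ≡-Reasoning

  sumTo-zero : ∀ g x → (∀ j → 1 ≤ j → j ≤ x → g j ≡ 0) → sumTo g x ≡ 0
  sumTo-zero g zero _ = refl
  sumTo-zero g (suc x) g≗0 = trans (sumTo-suc g x)
    (cong₂ _+_ (sumTo-zero g x (λ j 1≤j j≤x → g≗0 j 1≤j (m≤n⇒m≤1+n j≤x))) (g≗0 (suc x) (s≤s z≤n) ≤-refl))

  erase : (ℕ → ℕ) → ℕ → ℕ → ℕ
  erase g a j with j ≟ a
  ... | yes _ = 0
  ... | no _ = g j

  erase-≡ : ∀ g a → erase g a a ≡ 0
  erase-≡ g a with a ≟ a
  ... | yes _ = refl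
  ... | no a≢a = contradiction refl a≢a

  erase-≢ : ∀ g a j → j ≢ a → erase g a j ≡ g j
  erase-≢ g a j j≢a with j ≟ a
  ... | yes j≡a = contradiction j≡a j≢a
  ... | no _ = refl

  sumTo-erase : ∀ g a x → 1 ≤ a → a ≤ x → sumTo g x ≡ sumTo (erase g a) x + g a
  sumTo-erase g a zero 1≤a a≤0 = contradiction (≤-trans 1≤a a≤0) λ ()
  sumTo-erase g a (suc x) 1≤a a≤1+x with suc x ≟ a
  ... | yes refl = begin
      sumTo g (suc x)                                   ≡⟨ sumTo-suc g x ⟩
      sumTo g x + g (suc x)                             ≡⟨ cong (_+ g (suc x)) (sumTo-cong x (λ j _ j≤x → sym (erase-≢ g (suc x) j (<⇒≢ (s≤s j≤x))))) ⟩
      sumTo (erase g (suc x)) x + g (suc x)             ≡⟨ cong (λ z → z + g (suc x)) (+-identityʳ _) ⟨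
      sumTo (erase g (suc x)) x + 0 + g (suc x)         ≡⟨ cong (λ z → sumTo (erase g (suc x)) x + z + g (suc x)) (erase-≡ g (suc x)) ⟨
      sumTo (erase g (suc x)) x + erase g (suc x) (suc x) + g (suc x) ≡⟨ cong (_+ g (suc x)) (sumTo-suc (erase g (suc x)) x) ⟨
      sumTo (erase g (suc x)) (suc x) + g (suc x)       ∎
    where open ≡-Reasoning
  ... | no 1+x≢a = begin
      sumTo g (suc x)                                   ≡⟨ sumTo-suc g x ⟩
      sumTo g x + g (suc x)                             ≡⟨ cong (_+ g (suc x)) (sumTo-erase g a x 1≤a (≤-pred (≤∧≢⇒< a≤1+x (1+x≢a ∘ sym)))) ⟩
      sumTo (erase g a) x + g a + g (suc x)             ≡⟨ +-assoc (sumTo (erase g a) x) (g a) _ ⟩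
      sumTo (erase g a) x + (g a + g (suc x))           ≡⟨ cong (sumTo (erase g a) x +_) (+-comm (g a) _) ⟩
      sumTo (erase g a) x + (g (suc x) + g a)           ≡⟨ +-assoc (sumTo (erase g a) x) _ (g a) ⟨
      sumTo (erase g a) x + g (suc x) + g a             ≡⟨ cong (λ z → sumTo (erase g a) x + z + g a) (erase-≢ g a (suc x) 1+x≢a) ⟨
      sumTo (erase g a) x + erase g a (suc x) + g a     ≡⟨ cong (_+ g a) (sumTo-suc (erase g a) x) ⟨
      sumTo (erase g a) (suc x) + g a                   ∎
    where open ≡-Reasoning

  sumTo-support : ∀ g x (L : List ℕ) → Unique L →
    (∀ j → j ∈ L → g j ≢ 0 → 1 ≤ j × j ≤ x) → (∀ j → 1 ≤ j → j ≤ x → g j ≢ 0 → j ∈ L) →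
    sumTo g x ≡ sum (map g L)
  sumTo-support g x [] _ _ supp = sumTo-zero g x (λ j 1≤j j≤x → ≡0 (λ gj≢0 → supp j 1≤j j≤x gj≢0))
    where
    ≡0 : ∀ {j} → (g j ≢ 0 → j ∈ []) → g j ≡ 0
    ≡0 {j} f with g j ≟ 0
    ... | yes gj≡0 = gj≡0
    ... | no gj≢0 with f gj≢0
    ...   | ()
  sumTo-support g x (a ∷ L) (a∉L ∷ uniqueL) range supp with g a ≟ 0
  ... | yes ga≡0 = begin
      sumTo g x            ≡⟨ sumTo-support g x L uniqueL (λ j j∈L → range j (there j∈L)) supp′ ⟩
      sum (map g L)        ≡⟨ cong (_+ sum (map g L)) ga≡0 ⟨
      g a + sum (map g L)  ∎
    where
    open ≡-Reasoning
    supp′ : ∀ j → 1 ≤ j → j ≤ x → g j ≢ 0 → j ∈ L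
    supp′ j 1≤j j≤x gj≢0 with supp j 1≤j j≤x gj≢0
    ... | here refl = contradiction ga≡0 gj≢0
    ... | there j∈L = j∈L
  ... | no ga≢0 = begin
      sumTo g x                           ≡⟨ sumTo-erase g a x (proj₁ a-range) (proj₂ a-range) ⟩
      sumTo (erase g a) x + g a           ≡⟨ cong (_+ g a) (sumTo-support (erase g a) x L uniqueL range′ supp′) ⟩
      sum (map (erase g a) L) + g a       ≡⟨ cong (_+ g a) (sum-map-cong L (λ j j∈L → erase-≢ g a j (a≢ j∈L))) ⟩
      sum (map g L) + g a                 ≡⟨ +-comm _ (g a) ⟩
      g a + sum (map g L)                 ∎
    where
    open ≡-Reasoning
    a-range = range a (here refl) ga≢0
    a≢ : ∀ {j} → j ∈ L → j ≢ a
    a≢ j∈L j≡a = All.lookup a∉L j∈L (sym j≡a)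
    range′ : ∀ j → j ∈ L → erase g a j ≢ 0 → 1 ≤ j × j ≤ x
    range′ j j∈L ej≢0 = range j (there j∈L) (λ gj≡0 → ej≢0 (trans (erase-≢ g a j (a≢ j∈L)) gj≡0))
    supp′ : ∀ j → 1 ≤ j → j ≤ x → erase g a j ≢ 0 → j ∈ L
    supp′ j 1≤j j≤x ej≢0 = decide (j ≟ a)
      where
      decide : Dec (j ≡ a) → j ∈ L
      decide (yes refl) = contradiction (erase-≡ g a) ej≢0
      decide (no j≢a) with supp j 1≤j j≤x (λ gj≡0 → ej≢0 (trans (erase-≢ g a j j≢a) gj≡0))
      ... | here j≡a = contradiction j≡a j≢a
      ... | there j∈L = j∈L

  HasValuation : ℕ → ℕ → ℕ → Set
  HasValuation q x e = ∃ λ m → x ≡ q ^ e * m × ¬ q ∣ m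

  valuation-* : ∀ {q x y e f} → Prime q → HasValuation q x e → HasValuation q y f → HasValuation q (x * y) (e + f)
  valuation-* {q} {x} {y} {e} {f} q-prime (m , x≡ , q∤m) (m′ , y≡ , q∤m′) = m * m′ , xy≡ , q∤mm′
    where
    open ≡-Reasoning
    xy≡ : x * y ≡ q ^ (e + f) * (m * m′)
    xy≡ = begin
      x * y                         ≡⟨ cong₂ _*_ x≡ y≡ ⟩
      q ^ e * m * (q ^ f * m′)      ≡⟨ *-assoc (q ^ e) m _ ⟩
      q ^ e * (m * (q ^ f * m′))    ≡⟨ cong (q ^ e *_) (*-assoc m (q ^ f) m′) ⟨
      q ^ e * (m * q ^ f * m′)      ≡⟨ cong (λ z → q ^ e * (z * m′)) (*-comm m (q ^ f)) ⟩
      q ^ e * (q ^ f * m * m′)      ≡⟨ cong (q ^ e *_) (*-assoc (q ^ f) m m′) ⟩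
      q ^ e * (q ^ f * (m * m′))    ≡⟨ *-assoc (q ^ e) _ _ ⟨
      q ^ e * q ^ f * (m * m′)      ≡⟨ cong (_* (m * m′)) (^-distribˡ-+-* q e f) ⟨
      q ^ (e + f) * (m * m′)        ∎
    q∤mm′ : ¬ q ∣ m * m′
    q∤mm′ q∣ with euclidsLemma m m′ q-prime q∣
    ... | inj₁ q∣m = q∤m q∣m
    ... | inj₂ q∣m′ = q∤m′ q∣m′

  valuation-1 : ∀ {q} → Prime q → HasValuation q 1 0
  valuation-1 q-prime = 1 , refl , prime∤1 q-prime

  valuation-^ : ∀ {q} a → Prime q → HasValuation q (q ^ a) a
  valuation-^ {q} a q-prime = 1 , sym (*-identityʳ (q ^ a)) , prime∤1 q-prime

  valuation-^-other : ∀ {q r} a → Prime q → Prime r → q ≢ r → HasValuation q (r ^ a) 0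
  valuation-^-other {q} {r} a q-prime r-prime q≢r = r ^ a , sym (+-identityʳ (r ^ a)) , q≢r ∘ prime∣^⇒≡ a q-prime r-prime

  valuation⇒^∣ : ∀ {q x e j} → HasValuation q x e → j ≤ e → q ^ j ∣ x
  valuation⇒^∣ {q} {x} {e} {j} (m , x≡ , _) j≤e = divides (q ^ (e ∸ j) * m) (begin
    x                             ≡⟨ x≡ ⟩
    q ^ e * m                     ≡⟨ cong (λ z → q ^ z * m) (m∸n+n≡m j≤e) ⟨
    q ^ (e ∸ j + j) * m           ≡⟨ cong (_* m) (^-distribˡ-+-* q (e ∸ j) j) ⟩
    q ^ (e ∸ j) * q ^ j * m       ≡⟨ *-assoc (q ^ (e ∸ j)) _ m ⟩
    q ^ (e ∸ j) * (q ^ j * m)     ≡⟨ cong (q ^ (e ∸ j) *_) (*-comm (q ^ j) m) ⟩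
    q ^ (e ∸ j) * (m * q ^ j)     ≡⟨ *-assoc (q ^ (e ∸ j)) m _ ⟨
    q ^ (e ∸ j) * m * q ^ j       ∎)
    where open ≡-Reasoning

  ^∣⇒≤valuation : ∀ {q x e j} → Prime q → HasValuation q x e → q ^ j ∣ x → j ≤ e
  ^∣⇒≤valuation {q} {x} {e} {j} q-prime hv@(m , x≡ , q∤m) q^j∣x with j ≤? e
  ... | yes j≤e = j≤e
  ... | no j≰e = contradiction (*-cancelˡ-∣ (q ^ e) ⦃ m^n≢0 q e ⦄ q^e*q∣q^e*m) q∤m
    where
    instance
      q≢0 : NonZero q
      q≢0 = prime⇒nonZero q-prime
    q^e*q∣q^e*m : q ^ e * q ∣ q ^ e * m
    q^e*q∣q^e*m = subst₂ _∣_ (*-comm q (q ^ e)) x≡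
      (∣-trans (valuation⇒^∣ (valuation-^ j q-prime) (≰⇒> j≰e)) q^j∣x)

  valuation⇒≢0 : ∀ {q x e} → Prime q → HasValuation q x e → x ≢ 0
  valuation⇒≢0 {q} {x} {e} q-prime (m , x≡ , q∤m) x≡0 with m*n≡0⇒m≡0∨n≡0 (q ^ e) (trans (sym x≡) x≡0)
  ... | inj₁ q^e≡0 = ≢-nonZero⁻¹ q ⦃ prime⇒nonZero q-prime ⦄ (m^n≡0⇒m≡0 q e q^e≡0)
  ... | inj₂ refl = q∤m (q ∣0)

  m<2^m : ∀ m → m < 2 ^ m
  m<2^m zero = s≤s z≤n
  m<2^m (suc m) = begin-strict
    suc m            <⟨ s≤s (m<2^m m) ⟩
    suc (2 ^ m)      ≡⟨ +-comm 1 (2 ^ m) ⟩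
    2 ^ m + 1        ≤⟨ +-monoʳ-≤ (2 ^ m) (^-monoʳ-≤ 2 {0} {m} z≤n) ⟩
    2 ^ m + 2 ^ m    ≡⟨ cong (2 ^ m +_) (+-identityʳ (2 ^ m)) ⟨
    2 ^ suc m        ∎
    where open ≤-Reasoning

  valuation≤ : ∀ {q x e} → Prime q → HasValuation q x e → e ≤ x
  valuation≤ {q} {x} {e} q-prime hv@(m , x≡ , _) = begin
    e          ≤⟨ <⇒≤ (m<2^m e) ⟩
    2 ^ e      ≤⟨ ^-monoˡ-≤ e (nonTrivial⇒n>1 q ⦃ prime⇒nonTrivial q-prime ⦄) ⟩
    q ^ e      ≤⟨ m≤m*n (q ^ e) m ⦃ m≢0 ⦄ ⟩
    q ^ e * m  ≡⟨ x≡ ⟨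
    x          ∎
    where
    open ≤-Reasoning
    m≢0 : NonZero m
    m≢0 = ≢-nonZero λ { refl → valuation⇒≢0 {q} {x} {e} q-prime hv (trans x≡ (*-zeroʳ (q ^ e))) }

  countTo-cong : ∀ {P Q : ℕ → Set} (P? : Decidable P) (Q? : Decidable Q) → (∀ j → P j → Q j) → (∀ j → Q j → P j) →
    ∀ x → countTo P? x ≡ countTo Q? x
  countTo-cong P? Q? P⇒Q Q⇒P x = cong length (filter-≐ P? Q? ((λ {j} → P⇒Q j) , (λ {j} → Q⇒P j)) (oneTo x))

  countTo-none : ∀ {P : ℕ → Set} (P? : Decidable P) → (∀ j → ¬ P j) → ∀ x → countTo P? x ≡ 0
  countTo-none P? ¬P x = cong length (filter-none P? {oneTo x} (All.tabulate (λ {j} _ → ¬P j)))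

  countTo-≤ : ∀ e x → countTo (_≤? e) x ≡ x ⊓ e
  countTo-≤ e zero = refl
  countTo-≤ e (suc x) with suc x ≤? e
  ... | yes 1+x≤e = begin
      countTo (_≤? e) (suc x)              ≡⟨ countTo-suc (_≤? e) x ⟩
      countTo (_≤? e) x + indicator (suc x ≤? e) ≡⟨ cong₂ _+_ (countTo-≤ e x) (indicator-yes (suc x ≤? e) 1+x≤e) ⟩
      x ⊓ e + 1                            ≡⟨ cong (_+ 1) (m≤n⇒m⊓n≡m (≤-trans (n≤1+n x) 1+x≤e)) ⟩
      x + 1                                ≡⟨ +-comm x 1 ⟩
      suc x                                ≡⟨ m≤n⇒m⊓n≡m 1+x≤e ⟨
      suc x ⊓ e                            ∎
    where open ≡-Reasoning
  ... | no 1+x≰e = begin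
      countTo (_≤? e) (suc x)              ≡⟨ countTo-suc (_≤? e) x ⟩
      countTo (_≤? e) x + indicator (suc x ≤? e) ≡⟨ cong₂ _+_ (countTo-≤ e x) (indicator-no (suc x ≤? e) 1+x≰e) ⟩
      x ⊓ e + 0                            ≡⟨ +-identityʳ _ ⟩
      x ⊓ e                                ≡⟨ m≥n⇒m⊓n≡n e≤x ⟩
      e                                    ≡⟨ m≥n⇒m⊓n≡n (m≤n⇒m≤1+n e≤x) ⟨
      suc x ⊓ e                            ∎
    where
    open ≡-Reasoning
    e≤x = ≤-pred (≰⇒> 1+x≰e)

  signum : ℕ → ℕ
  signum zero = 0
  signum (suc _) = 1

  select : ℕ → ℕ → ℕ → ℕ
  select ℓ r x with ℓ ≟ r
  ... | yes _ = x
  ... | no _ = 0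

  select-≡ : ∀ ℓ x → select ℓ ℓ x ≡ x
  select-≡ ℓ x with ℓ ≟ ℓ
  ... | yes _ = refl
  ... | no ℓ≢ℓ = contradiction refl ℓ≢ℓ

  select-≢ : ∀ ℓ r x → ℓ ≢ r → select ℓ r x ≡ 0
  select-≢ ℓ r x ℓ≢r with ℓ ≟ r
  ... | yes ℓ≡r = contradiction ℓ≡r ℓ≢r
  ... | no _ = refl

  multiplicity : ∀ {k} → (Fin k → ℕ) → (Fin k → ℕ) → ℕ → ℕ
  multiplicity q b ℓ = sum (tabulate (λ i → select ℓ (q i) (b i)))

  valuation-prodPow : ∀ {k} (q b : Fin k → ℕ) → (∀ i → Prime (q i)) → ∀ {ℓ} → Prime ℓ →
    HasValuation ℓ (prodPow q b) (multiplicity q b ℓ)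
  valuation-prodPow {zero} q b _ ℓ-prime = valuation-1 ℓ-prime
  valuation-prodPow {suc k} q b q-prime {ℓ} ℓ-prime =
    valuation-* {e = select ℓ (q fzero) (b fzero)} {f = multiplicity (q ∘ fsuc) (b ∘ fsuc) ℓ} ℓ-prime head (valuation-prodPow (q ∘ fsuc) (b ∘ fsuc) (q-prime ∘ fsuc) ℓ-prime)
    where
    head : HasValuation ℓ (q fzero ^ b fzero) (select ℓ (q fzero) (b fzero))
    head with ℓ ≟ q fzero
    ... | yes refl = valuation-^ (b fzero) ℓ-prime
    ... | no ℓ≢q₀ = valuation-^-other (b fzero) ℓ-prime (q-prime fzero) ℓ≢q₀

  multiplicity-at : ∀ {k} (q b : Fin k → ℕ) → (∀ i j → q i ≡ q j → i ≡ j) → ∀ j → multiplicity q b (q j) ≡ b j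
  multiplicity-at {suc k} q b q-inj fzero = begin
    select (q fzero) (q fzero) (b fzero) + multiplicity (q ∘ fsuc) (b ∘ fsuc) (q fzero)
      ≡⟨ cong₂ _+_ (select-≡ (q fzero) (b fzero)) (sum-tabulate-cong {g = λ _ → 0} (λ i → select-≢ _ _ _ (λ q₀≡qᵢ → case (q-inj fzero (fsuc i) q₀≡qᵢ)))) ⟩
    b fzero + sum (tabulate {n = k} (λ _ → 0)) ≡⟨ cong (b fzero +_) (sum-zeros k) ⟩
    b fzero + 0                          ≡⟨ +-identityʳ (b fzero) ⟩
    b fzero                              ∎
    where
    open ≡-Reasoning
    case : ∀ {i : Fin k} → fzero ≢ fsuc i
    case ()
    sum-zeros : ∀ k → sum (tabulate {n = k} (λ _ → 0)) ≡ 0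
    sum-zeros zero = refl
    sum-zeros (suc k) = sum-zeros k
  multiplicity-at {suc k} q b q-inj (fsuc j) = begin
    select (q (fsuc j)) (q fzero) (b fzero) + multiplicity (q ∘ fsuc) (b ∘ fsuc) (q (fsuc j))
      ≡⟨ cong₂ _+_ (select-≢ _ _ _ (λ qⱼ≡q₀ → case (q-inj (fsuc j) fzero qⱼ≡q₀))) (multiplicity-at (q ∘ fsuc) (b ∘ fsuc) (λ i i′ eq → Fin.suc-injective (q-inj (fsuc i) (fsuc i′) eq)) j) ⟩
    b (fsuc j)                           ∎
    where
    open ≡-Reasoning
    case : ∀ {i : Fin k} → fsuc i ≢ fzero
    case ()

  multiplicity≢0 : ∀ {k} (q b : Fin k → ℕ) ℓ → multiplicity q b ℓ ≢ 0 → ∃ λ i → ℓ ≡ q i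
  multiplicity≢0 {zero} q b ℓ m≢0 = contradiction refl m≢0
  multiplicity≢0 {suc k} q b ℓ m≢0 = decide (ℓ ≟ q fzero)
    where
    decide : Dec (ℓ ≡ q fzero) → ∃ λ i → ℓ ≡ q i
    decide (yes ℓ≡q₀) = fzero , ℓ≡q₀
    decide (no ℓ≢q₀) with multiplicity≢0 (q ∘ fsuc) (b ∘ fsuc) ℓ (λ rest≡0 → m≢0 (cong₂ _+_ (select-≢ ℓ (q fzero) (b fzero) ℓ≢q₀) rest≡0))
    ... | i , ℓ≡qᵢ = fsuc i , ℓ≡qᵢ

  module _ {k} (q b : Fin k → ℕ) (q-injective : ∀ i j → q i ≡ q j → i ≡ j) (q-prime : ∀ i → Prime (q i)) where
    private
      n = prodPow q b

      hv : ∀ {ℓ} → Prime ℓ → HasValuation ℓ n (multiplicity q b ℓ)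
      hv = valuation-prodPow q b q-prime

      instance
        n≢0 : NonZero n
        n≢0 = ≢-nonZero (valuation⇒≢0 {e = multiplicity q b 2} prime[2] (hv prime[2]))

      ∣n : ∀ {ℓ} → Prime ℓ → multiplicity q b ℓ ≢ 0 → ℓ ∣ n
      ∣n {ℓ} ℓ-prime m≢0 = subst (_∣ n) (*-identityʳ ℓ) (valuation⇒^∣ (hv ℓ-prime) (n≢0⇒n>0 m≢0))

    sumTo-prodPow : ∀ g → (∀ ℓ → ¬ Prime ℓ → g ℓ ≡ 0) → (∀ ℓ → Prime ℓ → multiplicity q b ℓ ≡ 0 → g ℓ ≡ 0) →
      sumTo g n ≡ sum (tabulate (g ∘ q))
    sumTo-prodPow g g-nonprime g-outside = begin
      sumTo g n                  ≡⟨ sumTo-support g n (tabulate q) (tabulate⁺ (q-injective _ _)) range support ⟩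
      sum (map g (tabulate q))   ≡⟨ cong sum (map-tabulate q g) ⟩
      sum (tabulate (g ∘ q))     ∎
      where
      open ≡-Reasoning
      prime-support : ∀ ℓ → g ℓ ≢ 0 → Prime ℓ × multiplicity q b ℓ ≢ 0
      prime-support ℓ gℓ≢0 with prime? ℓ
      ... | no ¬prime = contradiction (g-nonprime ℓ ¬prime) gℓ≢0
      ... | yes ℓ-prime = ℓ-prime , λ m≡0 → gℓ≢0 (g-outside ℓ ℓ-prime m≡0)
      range : ∀ j → j ∈ tabulate q → g j ≢ 0 → 1 ≤ j × j ≤ n
      range j _ gj≢0 with prime-support j gj≢0
      ... | j-prime , m≢0 = ≤-trans (s≤s z≤n) (nonTrivial⇒n>1 j ⦃ prime⇒nonTrivial j-prime ⦄) , ∣⇒≤ (∣n j-prime m≢0)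
      support : ∀ j → 1 ≤ j → j ≤ n → g j ≢ 0 → j ∈ tabulate q
      support j _ _ gj≢0 with multiplicity≢0 q b j (proj₂ (prime-support j gj≢0))
      ... | i , refl = ∈-tabulate⁺ i

    Ω-prodPow : Ω n ≡ sum (tabulate b)
    Ω-prodPow = begin
      Ω n                                           ≡⟨ length-filter-concatMap PΩ (λ ℓ → map (ℓ ,_) (oneTo n)) (oneTo n) ⟩
      sum (map (λ ℓ → length (filter PΩ (map (ℓ ,_) (oneTo n)))) (oneTo n)) ≡⟨ sum-map-cong (oneTo n) (λ ℓ _ → length-filter-map PΩ (ℓ ,_) (oneTo n)) ⟩
      sumTo exponent n                              ≡⟨ sumTo-prodPow exponent exponent-nonprime (λ ℓ ℓ-prime m≡0 → trans (exponent-prime ℓ-prime) m≡0) ⟩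
      sum (tabulate (exponent ∘ q))                 ≡⟨ sum-tabulate-cong (λ i → trans (exponent-prime (q-prime i)) (multiplicity-at q b q-injective i)) ⟩
      sum (tabulate b)                              ∎
      where
      open ≡-Reasoning
      PΩ = λ (ℓj : ℕ × ℕ) → prime? (proj₁ ℓj) ×-dec ((proj₁ ℓj ^ proj₂ ℓj) ∣? n)
      exponent : ℕ → ℕ
      exponent ℓ = countTo (λ j → prime? ℓ ×-dec ((ℓ ^ j) ∣? n)) n
      exponent-nonprime : ∀ ℓ → ¬ Prime ℓ → exponent ℓ ≡ 0
      exponent-nonprime ℓ ¬prime = countTo-none _ (λ j → ¬prime ∘ proj₁) n
      exponent-prime : ∀ {ℓ} → Prime ℓ → exponent ℓ ≡ multiplicity q b ℓ
      exponent-prime {ℓ} ℓ-prime = begin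
        exponent ℓ                  ≡⟨ countTo-cong _ (_≤? multiplicity q b ℓ) (λ j → ^∣⇒≤valuation ℓ-prime (hv ℓ-prime) ∘ proj₂)
                                                                              (λ j j≤m → ℓ-prime , valuation⇒^∣ (hv ℓ-prime) j≤m) n ⟩
        countTo (_≤? multiplicity q b ℓ) n ≡⟨ countTo-≤ (multiplicity q b ℓ) n ⟩
        n ⊓ multiplicity q b ℓ      ≡⟨ m≥n⇒m⊓n≡n (valuation≤ ℓ-prime (hv ℓ-prime)) ⟩
        multiplicity q b ℓ          ∎

    ω-prodPow : ω n ≡ sum (tabulate (signum ∘ b))
    ω-prodPow = begin
      ω n                                ≡⟨ length-filter≡sum (λ ℓ → prime? ℓ ×-dec (ℓ ∣? n)) (oneTo n) ⟩
      sumTo isFactor n                   ≡⟨ sumTo-prodPow isFactor isFactor-nonprime (λ ℓ ℓ-prime m≡0 → trans (isFactor-prime ℓ-prime) (cong signum m≡0)) ⟩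
      sum (tabulate (isFactor ∘ q))      ≡⟨ sum-tabulate-cong (λ i → trans (isFactor-prime (q-prime i)) (cong signum (multiplicity-at q b q-injective i))) ⟩
      sum (tabulate (signum ∘ b))        ∎
      where
      open ≡-Reasoning
      isFactor : ℕ → ℕ
      isFactor ℓ = indicator (prime? ℓ ×-dec (ℓ ∣? n))
      isFactor-nonprime : ∀ ℓ → ¬ Prime ℓ → isFactor ℓ ≡ 0
      isFactor-nonprime ℓ ¬prime = indicator-no (prime? ℓ ×-dec (ℓ ∣? n)) (¬prime ∘ proj₁)
      isFactor-prime : ∀ {ℓ} → Prime ℓ → isFactor ℓ ≡ signum (multiplicity q b ℓ)
      isFactor-prime {ℓ} ℓ-prime with multiplicity q b ℓ | hv ℓ-prime
      ... | zero | h = indicator-no (prime? ℓ ×-dec (ℓ ∣? n))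
        (λ (_ , ℓ∣n) → contradiction (^∣⇒≤valuation {ℓ} {n} {0} {1} ℓ-prime h (subst (_∣ n) (sym (*-identityʳ ℓ)) ℓ∣n)) λ ())
      ... | suc v | h = indicator-yes (prime? ℓ ×-dec (ℓ ∣? n))
        (ℓ-prime , subst (_∣ n) (*-identityʳ ℓ) (valuation⇒^∣ {j = 1} h (s≤s (z≤n {v}))))

module Tables where

  open Representation
  open NormalForm
  open import Data.Nat as ℕ using (ℕ; suc; _≤_; s≤s; z≤n; _/_; _≤?_)
  open import Data.Nat.Properties using (≰⇒>)
  open import Data.Integer as ℤ using (ℤ; +_; -_)
  open import Data.Bool using (Bool; true; false; _∨_)
  open import Data.Product using (_×_; _,_)
  open import Data.Sum using (_⊎_; inj₁; inj₂)
  open import Relation.Nullary using (¬_; yes; no; contradiction)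
  open import Relation.Binary.PropositionalEquality

  valueAt1 : ℕ → ℕ → Bool → Bool → Bool → ℤ
  valueAt1 α β h5 h7 h11 = normalForm (base α β) h5 h7 h11 ! 1

  record Evaluates (α β : ℕ) (h5 h7 h11 : Bool) (ε δ K : ℕ) : Set where
    constructor evaluates
    field
      value : valueAt1 α β h5 h7 h11 ≡ sgnℤ (α ℕ.+ β ℕ.+ ε) ℤ.* ((- + 2) ℤ.^ flagCount h5 h7 h11 ℤ.* + (K ℕ.* 2 ℕ.^ δ))

  -- Since 2^α and 3^β mod 12 are periodic with period 2 from
  -- α = 2 and β = 1 on, base (α + 2) β ≡ base α β for α ≥ 3 and base α (β + 2) ≡ base α β for β ≥ 2
  -- hold by computation, which the recursive clauses use.
  table-i : ∀ α β h11 → α ≤ 1 → β ≡ 0 → Evaluates α β false true h11 0 0 3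
  table-i 0 0 true _ refl = evaluates refl
  table-i 0 0 false _ refl = evaluates refl
  table-i 1 0 true _ refl = evaluates refl
  table-i 1 0 false _ refl = evaluates refl
  table-i (suc (suc _)) _ _ (s≤s ()) _

  table-ii : ∀ α β h7 h11 → α ≤ 1 → 2 ≤ β → (h7 ∨ h11) ≡ true → Evaluates α β false h7 h11 1 1 3
  table-ii (suc (suc _)) _ _ _ (s≤s ()) _ _
  table-ii 0 (suc (suc (suc (suc β)))) h7 h11 α≤1 _ nonempty = evaluates (Evaluates.value (table-ii 0 (suc (suc β)) h7 h11 α≤1 (s≤s (s≤s z≤n)) nonempty))
  table-ii 1 (suc (suc (suc (suc β)))) h7 h11 α≤1 _ nonempty = evaluates (Evaluates.value (table-ii 1 (suc (suc β)) h7 h11 α≤1 (s≤s (s≤s z≤n)) nonempty))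
  table-ii 0 2 true true _ _ _ = evaluates refl
  table-ii 0 2 true false _ _ _ = evaluates refl
  table-ii 0 2 false true _ _ _ = evaluates refl
  table-ii 0 3 true true _ _ _ = evaluates refl
  table-ii 0 3 true false _ _ _ = evaluates refl
  table-ii 0 3 false true _ _ _ = evaluates refl
  table-ii 1 2 true true _ _ _ = evaluates refl
  table-ii 1 2 true false _ _ _ = evaluates refl
  table-ii 1 2 false true _ _ _ = evaluates refl
  table-ii 1 3 true true _ _ _ = evaluates refl
  table-ii 1 3 true false _ _ _ = evaluates refl
  table-ii 1 3 false true _ _ _ = evaluates refl
  table-ii _ _ false false _ _ ()
  table-ii _ 0 _ _ _ () _
  table-ii _ 1 _ _ _ (s≤s ()) _

  table-iii-5 : ∀ α β h11 → α ≤ 2 → β ≤ 1 → Evaluates α β true false h11 ((α ℕ.+ 1) / 2) 0 2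
  table-iii-5 0 0 true _ _ = evaluates refl
  table-iii-5 0 0 false _ _ = evaluates refl
  table-iii-5 0 1 true _ _ = evaluates refl
  table-iii-5 0 1 false _ _ = evaluates refl
  table-iii-5 1 0 true _ _ = evaluates refl
  table-iii-5 1 0 false _ _ = evaluates refl
  table-iii-5 1 1 true _ _ = evaluates refl
  table-iii-5 1 1 false _ _ = evaluates refl
  table-iii-5 2 0 true _ _ = evaluates refl
  table-iii-5 2 0 false _ _ = evaluates refl
  table-iii-5 2 1 true _ _ = evaluates refl
  table-iii-5 2 1 false _ _ = evaluates refl
  table-iii-5 (suc (suc (suc _))) _ _ (s≤s (s≤s ())) _
  table-iii-5 _ (suc (suc _)) _ _ (s≤s ())

  table-iii-11 : ∀ α β → (α ≤ 1 × β ≡ 1) ⊎ (α ≡ 2 × β ≤ 1) → Evaluates α β false false true ((α ℕ.+ 1) / 2) 0 2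
  table-iii-11 0 1 _ = evaluates refl
  table-iii-11 1 1 _ = evaluates refl
  table-iii-11 2 0 _ = evaluates refl
  table-iii-11 2 1 _ = evaluates refl
  table-iii-11 0 0 (inj₁ (_ , ()))
  table-iii-11 0 0 (inj₂ (() , _))
  table-iii-11 1 0 (inj₁ (_ , ()))
  table-iii-11 1 0 (inj₂ (() , _))
  table-iii-11 (suc (suc (suc _))) _ (inj₁ (s≤s () , _))
  table-iii-11 (suc (suc (suc _))) _ (inj₂ (() , _))
  table-iii-11 _ (suc (suc _)) (inj₁ (_ , ()))
  table-iii-11 _ (suc (suc _)) (inj₂ (_ , s≤s ()))

  table-iv : ∀ α β h5 h11 → 3 ≤ α → β ≤ 1 → (h5 ∨ h11) ≡ true → Evaluates α β h5 false h11 0 1 2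
  table-iv (suc (suc (suc (suc (suc α))))) β h5 h11 _ β≤1 nonempty = evaluates (Evaluates.value (table-iv (suc (suc (suc α))) β h5 h11 (s≤s (s≤s (s≤s z≤n))) β≤1 nonempty))
  table-iv 3 0 true true _ _ _ = evaluates refl
  table-iv 3 0 true false _ _ _ = evaluates refl
  table-iv 3 0 false true _ _ _ = evaluates refl
  table-iv 3 1 true true _ _ _ = evaluates refl
  table-iv 3 1 true false _ _ _ = evaluates refl
  table-iv 3 1 false true _ _ _ = evaluates refl
  table-iv 4 0 true true _ _ _ = evaluates refl
  table-iv 4 0 true false _ _ _ = evaluates refl
  table-iv 4 0 false true _ _ _ = evaluates refl
  table-iv 4 1 true true _ _ _ = evaluates refl
  table-iv 4 1 true false _ _ _ = evaluates refl
  table-iv 4 1 false true _ _ _ = evaluates refl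
  table-iv _ _ false false _ _ ()
  table-iv _ (suc (suc _)) _ _ _ (s≤s ()) _
  table-iv 0 _ _ _ () _ _
  table-iv 1 _ _ _ (s≤s ()) _ _
  table-iv 2 _ _ _ (s≤s (s≤s ())) _ _

  table-v : Evaluates 0 0 false false true 0 0 5
  table-v = evaluates refl

  table-vi : Evaluates 1 0 false false true 0 0 1
  table-vi = evaluates refl

  zero-7 : ∀ α β h11 → 2 ≤ α → valueAt1 α β false true h11 ≡ + 0
  zero-7 (suc (suc (suc (suc (suc α))))) β h11 _ = zero-7 (suc (suc (suc α))) β h11 (s≤s (s≤s z≤n))
  zero-7 α (suc (suc (suc (suc β)))) h11 2≤α = zero-7 α (suc (suc β)) h11 2≤α
  zero-7 2 0 true _ = refl
  zero-7 2 0 false _ = refl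
  zero-7 2 1 true _ = refl
  zero-7 2 1 false _ = refl
  zero-7 2 2 true _ = refl
  zero-7 2 2 false _ = refl
  zero-7 2 3 true _ = refl
  zero-7 2 3 false _ = refl
  zero-7 3 0 true _ = refl
  zero-7 3 0 false _ = refl
  zero-7 3 1 true _ = refl
  zero-7 3 1 false _ = refl
  zero-7 3 2 true _ = refl
  zero-7 3 2 false _ = refl
  zero-7 3 3 true _ = refl
  zero-7 3 3 false _ = refl
  zero-7 4 0 true _ = refl
  zero-7 4 0 false _ = refl
  zero-7 4 1 true _ = refl
  zero-7 4 1 false _ = refl
  zero-7 4 2 true _ = refl
  zero-7 4 2 false _ = refl
  zero-7 4 3 true _ = refl
  zero-7 4 3 false _ = refl
  zero-7 0 _ _ ()
  zero-7 1 _ _ (s≤s ())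

  zero-7-β≡1 : ∀ α h11 → α ≤ 1 → valueAt1 α 1 false true h11 ≡ + 0
  zero-7-β≡1 0 true _ = refl
  zero-7-β≡1 0 false _ = refl
  zero-7-β≡1 1 true _ = refl
  zero-7-β≡1 1 false _ = refl
  zero-7-β≡1 (suc (suc _)) _ (s≤s ())

  zero-11 : ∀ α β → 2 ≤ α → 2 ≤ β → valueAt1 α β false false true ≡ + 0
  zero-11 (suc (suc (suc (suc (suc α))))) β _ 2≤β = zero-11 (suc (suc (suc α))) β (s≤s (s≤s z≤n)) 2≤β
  zero-11 α (suc (suc (suc (suc β)))) 2≤α _ = zero-11 α (suc (suc β)) 2≤α (s≤s (s≤s z≤n))
  zero-11 2 2 _ _ = refl
  zero-11 2 3 _ _ = refl
  zero-11 3 2 _ _ = refl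
  zero-11 3 3 _ _ = refl
  zero-11 4 2 _ _ = refl
  zero-11 4 3 _ _ = refl
  zero-11 0 _ () _
  zero-11 1 _ (s≤s ()) _
  zero-11 _ 0 _ ()
  zero-11 _ 1 _ (s≤s ())

  zero-5 : ∀ α β h11 → 2 ≤ β → valueAt1 α β true false h11 ≡ + 0
  zero-5 (suc (suc (suc (suc (suc α))))) β h11 2≤β = zero-5 (suc (suc (suc α))) β h11 2≤β
  zero-5 α (suc (suc (suc (suc β)))) h11 _ = zero-5 α (suc (suc β)) h11 (s≤s (s≤s z≤n))
  zero-5 0 2 true _ = refl
  zero-5 0 2 false _ = refl
  zero-5 0 3 true _ = refl
  zero-5 0 3 false _ = refl
  zero-5 1 2 true _ = refl
  zero-5 1 2 false _ = refl
  zero-5 1 3 true _ = refl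
  zero-5 1 3 false _ = refl
  zero-5 2 2 true _ = refl
  zero-5 2 2 false _ = refl
  zero-5 2 3 true _ = refl
  zero-5 2 3 false _ = refl
  zero-5 3 2 true _ = refl
  zero-5 3 2 false _ = refl
  zero-5 3 3 true _ = refl
  zero-5 3 3 false _ = refl
  zero-5 4 2 true _ = refl
  zero-5 4 2 false _ = refl
  zero-5 4 3 true _ = refl
  zero-5 4 3 false _ = refl
  zero-5 _ 0 _ ()
  zero-5 _ 1 _ (s≤s ())

  zero-57 : ∀ α β h11 → valueAt1 α β true true h11 ≡ + 0
  zero-57 (suc (suc (suc (suc (suc α))))) β h11 = zero-57 (suc (suc (suc α))) β h11
  zero-57 α (suc (suc (suc (suc β)))) h11 = zero-57 α (suc (suc β)) h11
  zero-57 0 0 true = refl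
  zero-57 0 0 false = refl
  zero-57 0 1 true = refl
  zero-57 0 1 false = refl
  zero-57 0 2 true = refl
  zero-57 0 2 false = refl
  zero-57 0 3 true = refl
  zero-57 0 3 false = refl
  zero-57 1 0 true = refl
  zero-57 1 0 false = refl
  zero-57 1 1 true = refl
  zero-57 1 1 false = refl
  zero-57 1 2 true = refl
  zero-57 1 2 false = refl
  zero-57 1 3 true = refl
  zero-57 1 3 false = refl
  zero-57 2 0 true = refl
  zero-57 2 0 false = refl
  zero-57 2 1 true = refl
  zero-57 2 1 false = refl
  zero-57 2 2 true = refl
  zero-57 2 2 false = refl
  zero-57 2 3 true = refl
  zero-57 2 3 false = refl
  zero-57 3 0 true = refl
  zero-57 3 0 false = refl
  zero-57 3 1 true = refl
  zero-57 3 1 false = refl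
  zero-57 3 2 true = refl
  zero-57 3 2 false = refl
  zero-57 3 3 true = refl
  zero-57 3 3 false = refl
  zero-57 4 0 true = refl
  zero-57 4 0 false = refl
  zero-57 4 1 true = refl
  zero-57 4 1 false = refl
  zero-57 4 2 true = refl
  zero-57 4 2 false = refl
  zero-57 4 3 true = refl
  zero-57 4 3 false = refl

  data CaseFlags (α β : ℕ) : Bool → Bool → Bool → Set where
    case-i      : ∀ {h11} → α ≤ 1 → β ≡ 0 → CaseFlags α β false true h11
    case-ii     : ∀ {h7 h11} → α ≤ 1 → 2 ≤ β → (h7 ∨ h11) ≡ true → CaseFlags α β false h7 h11
    case-iii-5  : ∀ {h11} → α ≤ 2 → β ≤ 1 → CaseFlags α β true false h11
    case-iii-11 : (α ≤ 1 × β ≡ 1) ⊎ (α ≡ 2 × β ≤ 1) → CaseFlags α β false false true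
    case-iv     : ∀ {h5 h11} → 3 ≤ α → β ≤ 1 → (h5 ∨ h11) ≡ true → CaseFlags α β h5 false h11
    case-v      : α ≡ 0 → β ≡ 0 → CaseFlags α β false false true
    case-vi     : α ≡ 1 → β ≡ 0 → CaseFlags α β false false true

  outside-cases : ∀ α β h5 h7 h11 → ¬ CaseFlags α β h5 h7 h11 → (h5 ∨ h7 ∨ h11) ≡ true → valueAt1 α β h5 h7 h11 ≡ + 0
  outside-cases α β true true h11 _ _ = zero-57 α β h11
  outside-cases α β true false h11 ¬case _ with β ≤? 1 | α ≤? 2
  ... | no β≰1 | _ = zero-5 α β h11 (≰⇒> β≰1)
  ... | yes β≤1 | yes α≤2 = contradiction (case-iii-5 α≤2 β≤1) ¬case
  ... | yes β≤1 | no α≰2 = contradiction (case-iv (≰⇒> α≰2) β≤1 refl) ¬case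
  outside-cases α β false true h11 ¬case _ with α ≤? 1
  ... | no α≰1 = zero-7 α β h11 (≰⇒> α≰1)
  ... | yes α≤1 with β
  ...   | 0 = contradiction (case-i α≤1 refl) ¬case
  ...   | 1 = zero-7-β≡1 α h11 α≤1
  ...   | suc (suc _) = contradiction (case-ii α≤1 (s≤s (s≤s z≤n)) refl) ¬case
  outside-cases α β false false true ¬case _ with α | β
  ... | 0 | 0 = contradiction (case-v refl refl) ¬case
  ... | 1 | 0 = contradiction (case-vi refl refl) ¬case
  ... | 0 | 1 = contradiction (case-iii-11 (inj₁ (z≤n , refl))) ¬case
  ... | 1 | 1 = contradiction (case-iii-11 (inj₁ (s≤s z≤n , refl))) ¬case
  ... | 0 | suc (suc _) = contradiction (case-ii z≤n (s≤s (s≤s z≤n)) refl) ¬case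
  ... | 1 | suc (suc _) = contradiction (case-ii (s≤s z≤n) (s≤s (s≤s z≤n)) refl) ¬case
  ... | 2 | 0 = contradiction (case-iii-11 (inj₂ (refl , z≤n))) ¬case
  ... | 2 | 1 = contradiction (case-iii-11 (inj₂ (refl , s≤s z≤n))) ¬case
  ... | suc (suc (suc _)) | 0 = contradiction (case-iv (s≤s (s≤s (s≤s z≤n))) z≤n refl) ¬case
  ... | suc (suc (suc _)) | 1 = contradiction (case-iv (s≤s (s≤s (s≤s z≤n))) (s≤s z≤n) refl) ¬case
  ... | suc (suc α′) | suc (suc β′) = zero-11 (suc (suc α′)) (suc (suc β′)) (s≤s (s≤s z≤n)) (s≤s (s≤s z≤n))
  outside-cases α β false false false _ ()

module Cases where

  open import Defs
  open NormalForm using (NonTrivialUnit; five; seven; eleven; occurs)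
  open Tables using (CaseFlags; case-i; case-ii; case-iii-5; case-iii-11; case-iv; case-v; case-vi)
  open import Data.Nat as ℕ using (ℕ; zero; suc; _≡ᵇ_; _%_; _*_; s≤s)
  open import Data.Nat.Properties using (≡ᵇ⇒≡; ≡⇒≡ᵇ)
  open import Data.Nat.DivMod using (m%n<n; m≡m%n+[m/n]*n; %-distribˡ-*)
  open import Data.Nat.Divisibility using (_∣_; divides; ∣1⇒≡1; ∣m∣n⇒∣m+n; ∣n⇒∣m*n; ∣-trans)
  open import Data.Nat.GCD using (gcd; gcd-greatest)
  open import Data.Bool using (Bool; true; false; _∨_; T)
  open import Data.Bool.Properties using (∨-zeroʳ)
  open import Data.Fin using (Fin) renaming (zero to fzero; suc to fsuc)
  open import Data.List using (List; []; _∷_)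
  open import Data.List.Membership.Propositional using (_∈_)
  open import Data.List.Relation.Unary.Any using (here; there)
  open import Data.Product using (_×_; _,_; ∃; proj₁; proj₂)
  open import Data.Sum using (_⊎_; inj₁; inj₂)
  open import Data.Unit using (tt)
  open import Function using (_∘_)
  open import Relation.Nullary using (contradiction)
  open import Relation.Binary.PropositionalEquality

  consIf : Bool → ℕ → List ℕ → List ℕ
  consIf true x xs = x ∷ xs
  consIf false _ xs = xs

  residueList : Bool → Bool → Bool → List ℕ
  residueList h5 h7 h11 = consIf h5 5 (consIf h7 7 (consIf h11 11 []))

  CaseHolds : ℕ → ℕ → ∀ {k} → (Fin k → ℕ) → Set
  CaseHolds α β p = Case-i α β p ⊎ Case-ii α β p ⊎ Case-iii α β p ⊎ Case-iv α β p ⊎ Case-v α β p ⊎ Case-vi α β p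

  caseFlags⇒case : ∀ {α β h5 h7 h11 k} {p : Fin k → ℕ} → ResiduesAre p (residueList h5 h7 h11) →
    CaseFlags α β h5 h7 h11 → CaseHolds α β p
  caseFlags⇒case {h11 = true} ra (case-i α≤1 β≡0) = inj₁ (α≤1 , β≡0 , inj₁ ra)
  caseFlags⇒case {h11 = false} ra (case-i α≤1 β≡0) = inj₁ (α≤1 , β≡0 , inj₂ ra)
  caseFlags⇒case {h7 = true} {true} ra (case-ii α≤1 2≤β _) = inj₂ (inj₁ (α≤1 , 2≤β , inj₁ ra))
  caseFlags⇒case {h7 = true} {false} ra (case-ii α≤1 2≤β _) = inj₂ (inj₁ (α≤1 , 2≤β , inj₂ (inj₁ ra)))
  caseFlags⇒case {h7 = false} {true} ra (case-ii α≤1 2≤β _) = inj₂ (inj₁ (α≤1 , 2≤β , inj₂ (inj₂ ra)))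
  caseFlags⇒case {h7 = false} {false} ra (case-ii _ _ ())
  caseFlags⇒case {h11 = true} ra (case-iii-5 α≤2 β≤1) = inj₂ (inj₂ (inj₁ (inj₁ (α≤2 , β≤1 , inj₁ ra))))
  caseFlags⇒case {h11 = false} ra (case-iii-5 α≤2 β≤1) = inj₂ (inj₂ (inj₁ (inj₁ (α≤2 , β≤1 , inj₂ ra))))
  caseFlags⇒case ra (case-iii-11 (inj₁ (α≤1 , β≡1))) = inj₂ (inj₂ (inj₁ (inj₂ (inj₁ (α≤1 , β≡1 , ra)))))
  caseFlags⇒case ra (case-iii-11 (inj₂ (α≡2 , β≤1))) = inj₂ (inj₂ (inj₁ (inj₂ (inj₂ (α≡2 , β≤1 , ra)))))
  caseFlags⇒case {h5 = true} {h11 = true} ra (case-iv 3≤α β≤1 _) = inj₂ (inj₂ (inj₂ (inj₁ (3≤α , β≤1 , inj₁ ra))))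
  caseFlags⇒case {h5 = true} {h11 = false} ra (case-iv 3≤α β≤1 _) = inj₂ (inj₂ (inj₂ (inj₁ (3≤α , β≤1 , inj₂ (inj₁ ra)))))
  caseFlags⇒case {h5 = false} {h11 = true} ra (case-iv 3≤α β≤1 _) = inj₂ (inj₂ (inj₂ (inj₁ (3≤α , β≤1 , inj₂ (inj₂ ra)))))
  caseFlags⇒case {h5 = false} {h11 = false} ra (case-iv _ _ ())
  caseFlags⇒case ra (case-v α≡0 β≡0) = inj₂ (inj₂ (inj₂ (inj₂ (inj₁ (α≡0 , β≡0 , ra)))))
  caseFlags⇒case ra (case-vi α≡1 β≡0) = inj₂ (inj₂ (inj₂ (inj₂ (inj₂ (α≡1 , β≡0 , ra)))))

  flag : ℕ → Bool → Bool → Bool → Bool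
  flag 5 h5 _ _ = h5
  flag 7 _ h7 _ = h7
  flag 11 _ _ h11 = h11
  flag _ _ _ _ = false

  ∈-consIf⁻ : ∀ {y x h xs} → y ∈ consIf h x xs → (y ≡ x × h ≡ true) ⊎ y ∈ xs
  ∈-consIf⁻ {h = true} (here y≡x) = inj₁ (y≡x , refl)
  ∈-consIf⁻ {h = true} (there y∈xs) = inj₂ y∈xs
  ∈-consIf⁻ {h = false} y∈xs = inj₂ y∈xs

  ∈-consIf⁺ : ∀ {y x} h {xs} → y ∈ xs → y ∈ consIf h x xs
  ∈-consIf⁺ true y∈xs = there y∈xs
  ∈-consIf⁺ false y∈xs = y∈xs

  ∈-residueList⁻ : ∀ {y h5 h7 h11} → y ∈ residueList h5 h7 h11 → NonTrivialUnit y × flag y h5 h7 h11 ≡ true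
  ∈-residueList⁻ {h5 = h5} {h7} {h11} y∈ with ∈-consIf⁻ {h = h5} y∈
  ... | inj₁ (refl , refl) = five , refl
  ... | inj₂ y∈′ with ∈-consIf⁻ {h = h7} y∈′
  ...   | inj₁ (refl , refl) = seven , refl
  ...   | inj₂ y∈″ with ∈-consIf⁻ {h = h11} y∈″
  ...     | inj₁ (refl , refl) = eleven , refl
  ...     | inj₂ ()

  ∈-residueList⁺ : ∀ {u} h5 h7 h11 → NonTrivialUnit u → flag u h5 h7 h11 ≡ true → u ∈ residueList h5 h7 h11
  ∈-residueList⁺ true h7 h11 five _ = here refl
  ∈-residueList⁺ h5 true h11 seven _ = ∈-consIf⁺ h5 (here refl)
  ∈-residueList⁺ h5 h7 true eleven _ = ∈-consIf⁺ h5 (∈-consIf⁺ h7 (here refl))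

  occurs-witness : ∀ u {k} (r : Fin k → ℕ) → occurs u r ≡ true → ∃ λ i → r i ≡ u
  occurs-witness u {zero} r ()
  occurs-witness u {suc k} r occ with r fzero ≡ᵇ u in r₀≡ᵇu
  ... | true = fzero , ≡ᵇ⇒≡ (r fzero) u (subst T (sym r₀≡ᵇu) tt)
  ... | false with occurs-witness u (r ∘ fsuc) occ
  ...   | i , rᵢ≡u = fsuc i , rᵢ≡u

  occurs-true : ∀ u {k} (r : Fin k → ℕ) i → r i ≡ u → occurs u r ≡ true
  occurs-true u {suc k} r fzero r₀≡u with r fzero ≡ᵇ u in r₀≡ᵇu
  ... | true = refl
  ... | false = contradiction (subst T r₀≡ᵇu (≡⇒≡ᵇ (r fzero) u r₀≡u)) λ ()
  occurs-true u {suc k} r (fsuc i) rᵢ≡u = trans (cong ((r fzero ≡ᵇ u) ∨_) (occurs-true u (r ∘ fsuc) i rᵢ≡u)) (∨-zeroʳ _)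

  occurs-false : ∀ u {k} (r : Fin k → ℕ) → (∀ i → r i ≢ u) → occurs u r ≡ false
  occurs-false u r r≢u with occurs u r in occ
  ... | true = let (i , rᵢ≡u) = occurs-witness u r occ in contradiction rᵢ≡u (r≢u i)
  ... | false = refl

  module _ {k} (p : Fin k → ℕ) where
    private
      r : Fin k → ℕ
      r i = p i % 12

    units-of-residues : ∀ {h5 h7 h11} → ResiduesAre p (residueList h5 h7 h11) → ∀ i → NonTrivialUnit (r i)
    units-of-residues {h5} {h7} {h11} (r∈ , _) i = proj₁ (∈-residueList⁻ {h5 = h5} {h7} {h11} (r∈ i))

    occurs-of-residues : ∀ {h5 h7 h11 u} → ResiduesAre p (residueList h5 h7 h11) → NonTrivialUnit u →
      occurs u r ≡ flag u h5 h7 h11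
    occurs-of-residues {h5} {h7} {h11} {u} (r∈ , ∈r) unit with flag u h5 h7 h11 in flag≡
    ... | true = let (i , rᵢ≡u) = ∈r u (∈-residueList⁺ h5 h7 h11 unit flag≡) in occurs-true u r i rᵢ≡u
    ... | false = occurs-false u r (λ i rᵢ≡u → contradiction (trans (sym flag≡) (subst (λ y → flag y h5 h7 h11 ≡ true) rᵢ≡u (proj₂ (∈-residueList⁻ (r∈ i))))) λ ())

    residues-of-units : (∀ i → NonTrivialUnit (r i)) → ResiduesAre p (residueList (occurs 5 r) (occurs 7 r) (occurs 11 r))
    residues-of-units units = r∈ , ∈r
      where
      flag-occurs : ∀ {u} → NonTrivialUnit u → flag u (occurs 5 r) (occurs 7 r) (occurs 11 r) ≡ occurs u r
      flag-occurs five = refl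
      flag-occurs seven = refl
      flag-occurs eleven = refl
      r∈ : ∀ i → r i ∈ residueList (occurs 5 r) (occurs 7 r) (occurs 11 r)
      r∈ i = ∈-residueList⁺ _ _ _ (units i) (trans (flag-occurs (units i)) (occurs-true (r i) r i refl))
      ∈r : ∀ y → y ∈ residueList (occurs 5 r) (occurs 7 r) (occurs 11 r) → ∃ λ i → r i ≡ y
      ∈r y y∈ with ∈-residueList⁻ y∈
      ... | unit , flag≡ = occurs-witness y r (trans (sym (flag-occurs unit)) flag≡)

  coprime6-excludes : ∀ {x d} → gcd x 6 ≡ 1 → d ∣ 6 → d ∣ x % 12 → d ≢ 1 → ∀ {A : Set} → A
  coprime6-excludes {x} {d} x⊥6 d∣6 d∣r d≢1 = contradiction (∣1⇒≡1 (subst (d ∣_) x⊥6 (gcd-greatest d∣x d∣6))) d≢1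
    where
    d∣x : d ∣ x
    d∣x = subst (d ∣_) (sym (m≡m%n+[m/n]*n x 12)) (∣m∣n⇒∣m+n d∣r (∣n⇒∣m*n (x ℕ./ 12) (∣-trans d∣6 (divides 2 refl))))

  residue-coprime6 : ∀ x → gcd x 6 ≡ 1 → x % 12 ≡ 1 ⊎ NonTrivialUnit (x % 12)
  residue-coprime6 x x⊥6 with x % 12 in x%12≡ | m%n<n x 12
  ... | 0 | _ = coprime6-excludes {x} x⊥6 (divides 3 refl) (subst (2 ∣_) (sym x%12≡) (divides 0 refl)) λ ()
  ... | 1 | _ = inj₁ refl
  ... | 2 | _ = coprime6-excludes {x} x⊥6 (divides 3 refl) (subst (2 ∣_) (sym x%12≡) (divides 1 refl)) λ ()
  ... | 3 | _ = coprime6-excludes {x} x⊥6 (divides 2 refl) (subst (3 ∣_) (sym x%12≡) (divides 1 refl)) λ ()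
  ... | 4 | _ = coprime6-excludes {x} x⊥6 (divides 3 refl) (subst (2 ∣_) (sym x%12≡) (divides 2 refl)) λ ()
  ... | 5 | _ = inj₂ five
  ... | 6 | _ = coprime6-excludes {x} x⊥6 (divides 3 refl) (subst (2 ∣_) (sym x%12≡) (divides 3 refl)) λ ()
  ... | 7 | _ = inj₂ seven
  ... | 8 | _ = coprime6-excludes {x} x⊥6 (divides 3 refl) (subst (2 ∣_) (sym x%12≡) (divides 4 refl)) λ ()
  ... | 9 | _ = coprime6-excludes {x} x⊥6 (divides 2 refl) (subst (3 ∣_) (sym x%12≡) (divides 3 refl)) λ ()
  ... | 10 | _ = coprime6-excludes {x} x⊥6 (divides 3 refl) (subst (2 ∣_) (sym x%12≡) (divides 5 refl)) λ ()
  ... | 11 | _ = inj₂ eleven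
  ... | suc (suc (suc (suc (suc (suc (suc (suc (suc (suc (suc (suc _))))))))))) | s≤s (s≤s (s≤s (s≤s (s≤s (s≤s (s≤s (s≤s (s≤s (s≤s (s≤s (s≤s ())))))))))))

  square-mod12 : ∀ x → gcd x 6 ≡ 1 → (x * x) % 12 ≡ 1
  square-mod12 x x⊥6 = trans (%-distribˡ-* x x 12) (square (residue-coprime6 x x⊥6))
    where
    square : ∀ {u} → u ≡ 1 ⊎ NonTrivialUnit u → (u * u) % 12 ≡ 1
    square (inj₁ refl) = refl
    square (inj₂ five) = refl
    square (inj₂ seven) = refl
    square (inj₂ eleven) = refl

  some-or-all : ∀ {k} {P Q : Fin k → Set} → (∀ i → P i ⊎ Q i) → (∃ λ i → P i) ⊎ (∀ i → Q i)
  some-or-all {zero} _ = inj₂ λ ()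
  some-or-all {suc k} P⊎Q with P⊎Q fzero | some-or-all (P⊎Q ∘ fsuc)
  ... | inj₁ P₀ | _ = inj₁ (fzero , P₀)
  ... | inj₂ _ | inj₁ (i , Pᵢ) = inj₁ (fsuc i , Pᵢ)
  ... | inj₂ Q₀ | inj₂ Q = inj₂ λ { fzero → Q₀ ; (fsuc i) → Q i }

  occurs-some : ∀ {k} (r : Fin k → ℕ) i → NonTrivialUnit (r i) → (occurs 5 r ∨ occurs 7 r ∨ occurs 11 r) ≡ true
  occurs-some r i unit with r i in rᵢ≡ | unit
  ... | .5 | five rewrite occurs-true 5 r i rᵢ≡ = refl
  ... | .7 | seven rewrite occurs-true 7 r i rᵢ≡ = ∨-zeroʳ (occurs 5 r)
  ... | .11 | eleven rewrite occurs-true 11 r i rᵢ≡ = trans (cong (occurs 5 r ∨_) (∨-zeroʳ (occurs 7 r))) (∨-zeroʳ (occurs 5 r))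

module RationalForm where

  open import Defs using (⟦_⟧; _÷_; sgn)
  open NormalForm using (sgnℤ)
  open import Data.Nat as ℕ using (ℕ; suc)
  import Data.Nat.Properties as ℕP
  open import Data.Integer as ℤ using (ℤ; +_)
  import Data.Integer.Properties as ℤP
  import Data.Integer.Tactic.RingSolver as ℤSolver
  open import Data.Rational as ℚ using (ℚ; _*_; _+_; 1ℚ; -_; 0ℚ)
  import Data.Rational.Properties as ℚP
  import Data.Rational.Unnormalised as ℚᵘ
  import Data.Rational.Unnormalised.Properties as ℚᵘP
  open import Data.Rational.Solver using (module +-*-Solver)
  open +-*-Solver using (solve; _:=_; con; _:*_; _:+_; :-_)
  open import Data.Product using (_×_; _,_)
  open import Data.Sum using (_⊎_; inj₁; inj₂)
  open import Relation.Binary.PropositionalEquality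

  private
    ⟦⟧ᵘ : ∀ m → ℚ.toℚᵘ ⟦ m ⟧ ℚᵘ.≃ ℚᵘ.mkℚᵘ (+ m) 0
    ⟦⟧ᵘ m = ℚP.toℚᵘ-fromℚᵘ (ℚᵘ.mkℚᵘ (+ m) 0)

  ⟦+⟧ : ∀ u v → ⟦ u ℕ.+ v ⟧ ≡ ⟦ u ⟧ + ⟦ v ⟧
  ⟦+⟧ u v = ℚP.toℚᵘ-injective (ℚᵘP.≃-trans (⟦⟧ᵘ (u ℕ.+ v)) (ℚᵘP.≃-trans sum≃
    (ℚᵘP.≃-sym (ℚᵘP.≃-trans (ℚP.toℚᵘ-homo-+ ⟦ u ⟧ ⟦ v ⟧) (ℚᵘP.+-cong (⟦⟧ᵘ u) (⟦⟧ᵘ v))))))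
    where
    unit : ∀ (a b : ℤ) → (a ℤ.* + 1 ℤ.+ b ℤ.* + 1) ℤ.* + 1 ≡ (a ℤ.+ b) ℤ.* + 1
    unit = ℤSolver.solve-∀
    sum≃ : ℚᵘ.mkℚᵘ (+ (u ℕ.+ v)) 0 ℚᵘ.≃ (ℚᵘ.mkℚᵘ (+ u) 0 ℚᵘ.+ ℚᵘ.mkℚᵘ (+ v) 0)
    sum≃ = ℚᵘ.*≡* (trans (cong (ℤ._* + 1) (ℤP.pos-+ u v)) (sym (unit (+ u) (+ v))))

  ⟦*⟧ : ∀ u v → ⟦ u ℕ.* v ⟧ ≡ ⟦ u ⟧ * ⟦ v ⟧
  ⟦*⟧ u v = ℚP.toℚᵘ-injective (ℚᵘP.≃-trans (⟦⟧ᵘ (u ℕ.* v)) (ℚᵘP.≃-trans product≃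
    (ℚᵘP.≃-sym (ℚᵘP.≃-trans (ℚP.toℚᵘ-homo-* ⟦ u ⟧ ⟦ v ⟧) (ℚᵘP.*-cong (⟦⟧ᵘ u) (⟦⟧ᵘ v))))))
    where
    product≃ : ℚᵘ.mkℚᵘ (+ (u ℕ.* v)) 0 ℚᵘ.≃ (ℚᵘ.mkℚᵘ (+ u) 0 ℚᵘ.* ℚᵘ.mkℚᵘ (+ v) 0)
    product≃ = ℚᵘ.*≡* (cong (ℤ._* + 1) (ℤP.pos-* u v))

  neg-involutive : ∀ q → - - q ≡ q
  neg-involutive = solve 1 (λ q → :- (:- q) := q) refl

  sgnℤ-sgn : ∀ m → (sgnℤ m ≡ + 1 × sgn m ≡ 1ℚ) ⊎ (sgnℤ m ≡ ℤ.- + 1 × sgn m ≡ - 1ℚ)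
  sgnℤ-sgn 0 = inj₁ (refl , refl)
  sgnℤ-sgn 1 = inj₂ (refl , refl)
  sgnℤ-sgn (suc (suc m)) with sgnℤ-sgn m
  ... | inj₁ (z≡1 , q≡1) = inj₁ (z≡1 , trans (neg-involutive (sgn m)) q≡1)
  ... | inj₂ (z≡-1 , q≡-1) = inj₂ (z≡-1 , trans (neg-involutive (sgn m)) q≡-1)

  pos-difference-pos : ∀ a b c → + a ℤ.- + b ≡ + c → a ≡ b ℕ.+ c
  pos-difference-pos a b c eq = ℤP.+-injective (begin
    + a                          ≡⟨ shift (+ a) (+ b) ⟩
    (+ a ℤ.- + b) ℤ.+ + b        ≡⟨ cong (ℤ._+ + b) eq ⟩
    + c ℤ.+ + b                  ≡⟨ ℤP.pos-+ c b ⟨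
    + (c ℕ.+ b)                  ≡⟨ cong +_ (ℕP.+-comm c b) ⟩
    + (b ℕ.+ c)                  ∎)
    where
    open ≡-Reasoning
    shift : ∀ x y → x ≡ (x ℤ.- y) ℤ.+ y
    shift = ℤSolver.solve-∀

  pos-difference-neg : ∀ a b c → + a ℤ.- + b ≡ ℤ.- + c → a ℕ.+ c ≡ b
  pos-difference-neg a b c eq = ℤP.+-injective (begin
    + (a ℕ.+ c)                  ≡⟨ ℤP.pos-+ a c ⟩
    + a ℤ.+ + c                  ≡⟨ shift (+ a) (+ b) (+ c) ⟩
    ((+ a ℤ.- + b) ℤ.+ + c) ℤ.+ + b ≡⟨ cong (λ z → (z ℤ.+ + c) ℤ.+ + b) eq ⟩
    (ℤ.- + c ℤ.+ + c) ℤ.+ + b    ≡⟨ cong (ℤ._+ + b) (ℤP.+-inverseˡ (+ c)) ⟩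
    + 0 ℤ.+ + b                  ≡⟨ ℤP.+-identityˡ (+ b) ⟩
    + b                          ∎)
    where
    open ≡-Reasoning
    shift : ∀ x y z → x ℤ.+ z ≡ ((x ℤ.- y) ℤ.+ z) ℤ.+ y
    shift = ℤSolver.solve-∀

  twelfths : ∀ x y M m → + (12 ℕ.* x) ℤ.- + y ≡ sgnℤ m ℤ.* + M → ⟦ x ⟧ ≡ (1 ÷ 12) * ⟦ y ⟧ + (1 ÷ 12) * sgn m * ⟦ M ⟧
  twelfths x y M m eq with sgnℤ-sgn m
  ... | inj₁ (z≡1 , q≡1) = begin
      ⟦ x ⟧                                       ≡⟨ divide ⟦ x ⟧ ⟩
      (1 ÷ 12) * (⟦ 12 ⟧ * ⟦ x ⟧)                 ≡⟨ cong ((1 ÷ 12) *_) (trans (sym (⟦*⟧ 12 x)) (trans (cong ⟦_⟧ nat) (⟦+⟧ y M))) ⟩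
      (1 ÷ 12) * (⟦ y ⟧ + ⟦ M ⟧)                  ≡⟨ distribute ⟦ y ⟧ ⟦ M ⟧ ⟩
      (1 ÷ 12) * ⟦ y ⟧ + (1 ÷ 12) * 1ℚ * ⟦ M ⟧    ≡⟨ cong (λ s → (1 ÷ 12) * ⟦ y ⟧ + (1 ÷ 12) * s * ⟦ M ⟧) q≡1 ⟨
      (1 ÷ 12) * ⟦ y ⟧ + (1 ÷ 12) * sgn m * ⟦ M ⟧ ∎
    where
    open ≡-Reasoning
    nat : 12 ℕ.* x ≡ y ℕ.+ M
    nat = pos-difference-pos (12 ℕ.* x) y M (trans eq (trans (cong (ℤ._* + M) z≡1) (ℤP.*-identityˡ (+ M))))
    divide : ∀ X → X ≡ (1 ÷ 12) * (⟦ 12 ⟧ * X)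
    divide = solve 1 (λ X → X := con (1 ÷ 12) :* (con ⟦ 12 ⟧ :* X)) refl
    distribute : ∀ Y Z → (1 ÷ 12) * (Y + Z) ≡ (1 ÷ 12) * Y + (1 ÷ 12) * 1ℚ * Z
    distribute = solve 2 (λ Y Z → con (1 ÷ 12) :* (Y :+ Z) := con (1 ÷ 12) :* Y :+ con (1 ÷ 12) :* con 1ℚ :* Z) refl
  ... | inj₂ (z≡-1 , q≡-1) = begin
      ⟦ x ⟧                                         ≡⟨ divide ⟦ x ⟧ ⟦ M ⟧ ⟩
      (1 ÷ 12) * ((⟦ 12 ⟧ * ⟦ x ⟧ + ⟦ M ⟧) + - ⟦ M ⟧) ≡⟨ cong (λ z → (1 ÷ 12) * (z + - ⟦ M ⟧)) (trans (cong (_+ ⟦ M ⟧) (sym (⟦*⟧ 12 x))) (trans (sym (⟦+⟧ (12 ℕ.* x) M)) (cong ⟦_⟧ nat))) ⟩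
      (1 ÷ 12) * (⟦ y ⟧ + - ⟦ M ⟧)                  ≡⟨ distribute ⟦ y ⟧ ⟦ M ⟧ ⟩
      (1 ÷ 12) * ⟦ y ⟧ + (1 ÷ 12) * - 1ℚ * ⟦ M ⟧    ≡⟨ cong (λ s → (1 ÷ 12) * ⟦ y ⟧ + (1 ÷ 12) * s * ⟦ M ⟧) q≡-1 ⟨
      (1 ÷ 12) * ⟦ y ⟧ + (1 ÷ 12) * sgn m * ⟦ M ⟧   ∎
    where
    open ≡-Reasoning
    nat : 12 ℕ.* x ℕ.+ M ≡ y
    nat = pos-difference-neg (12 ℕ.* x) y M (trans eq (trans (cong (ℤ._* + M) z≡-1) (ℤP.-1*i≡-i (+ M))))
    divide : ∀ X Z → X ≡ (1 ÷ 12) * ((⟦ 12 ⟧ * X + Z) + - Z)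
    divide = solve 2 (λ X Z → X := con (1 ÷ 12) :* ((con ⟦ 12 ⟧ :* X :+ Z) :+ (:- Z))) refl
    distribute : ∀ Y Z → (1 ÷ 12) * (Y + - Z) ≡ (1 ÷ 12) * Y + (1 ÷ 12) * - 1ℚ * Z
    distribute = solve 2 (λ Y Z → con (1 ÷ 12) :* (Y :+ (:- Z)) := con (1 ÷ 12) :* Y :+ con (1 ÷ 12) :* con (- 1ℚ) :* Z) refl

  twelfths₀ : ∀ x y → + (12 ℕ.* x) ℤ.- + y ≡ + 0 → ⟦ x ⟧ ≡ (1 ÷ 12) * ⟦ y ⟧
  twelfths₀ x y eq = begin
    ⟦ x ⟧                                   ≡⟨ twelfths x y 0 0 (trans eq (sym (ℤP.*-zeroʳ (+ 1)))) ⟩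
    (1 ÷ 12) * ⟦ y ⟧ + (1 ÷ 12) * 1ℚ * 0ℚ   ≡⟨ cong (_+_ ((1 ÷ 12) * ⟦ y ⟧)) (ℚP.*-zeroʳ ((1 ÷ 12) * 1ℚ)) ⟩
    (1 ÷ 12) * ⟦ y ⟧ + 0ℚ                   ≡⟨ ℚP.+-identityʳ _ ⟩
    (1 ÷ 12) * ⟦ y ⟧                        ∎
    where open ≡-Reasoning

module Formulas where

  open import Defs
  open Primes
  open Representation
  open Counting using (coprimeCount)
  open NormalForm
  open PrimeFactors using (Ω-prodPow; ω-prodPow; signum)
  open Tables
  open Cases
  open RationalForm
  open import Data.Nat as ℕ using (ℕ; zero; suc; pred; _≤_; _∸_; _^_; _%_; _/_; s≤s)
  open import Data.Nat.Properties as ℕP using (+-identityʳ; +-comm; *-assoc)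
  open import Data.Nat.DivMod using (n/1≡n)
  open import Data.Nat.Divisibility using (_∣_)
  open import Data.Nat.GCD using (gcd)
  open import Data.Nat.Primality using (Prime; prime[2]; euclidsLemma)
  open import Data.Nat.ListAction using (sum)
  open import Data.Integer as ℤ using (ℤ; +_; -_)
  import Data.Integer.Properties as ℤP
  import Data.Integer.Tactic.RingSolver as ℤSolver
  import Data.Nat.Tactic.RingSolver as ℕSolver
  open import Data.Rational as ℚ using (ℚ; _*_; _+_)
  open import Data.Rational.Solver using (module +-*-Solver)
  open import Data.Bool using (true; false)
  open import Data.Fin using (Fin) renaming (zero to fzero; suc to fsuc)
  open import Data.List using (tabulate)
  open import Data.Product using (_×_; _,_; ∃; proj₁; proj₂)
  open import Data.Sum using (_⊎_; inj₁; inj₂)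
  open import Function using (_∘_)
  open import Relation.Nullary using (¬_; contradiction)
  open import Relation.Binary.PropositionalEquality

  ω-exponent-i : ∀ α β k → α ≤ 1 → β ≡ 0 → k ℕ.+ 0 ≡ signum α ℕ.+ (signum β ℕ.+ k) ∸ α
  ω-exponent-i 0 0 k _ refl = +-identityʳ k
  ω-exponent-i 1 0 k _ refl = +-identityʳ k
  ω-exponent-i (suc (suc _)) _ _ (s≤s ()) _

  ω-exponent-ii : ∀ α β k → α ≤ 1 → 2 ≤ β → k ℕ.+ 1 ≡ signum α ℕ.+ (signum β ℕ.+ k) ∸ α
  ω-exponent-ii 0 (suc (suc _)) k _ _ = +-comm k 1
  ω-exponent-ii 1 (suc (suc _)) k _ _ = +-comm k 1
  ω-exponent-ii (suc (suc _)) _ _ (s≤s ()) _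
  ω-exponent-ii _ 0 _ _ ()
  ω-exponent-ii _ 1 _ _ (s≤s ())

  ω-exponent-iii : ∀ α β k → α ≤ 2 → β ≤ 1 → k ℕ.+ 0 ≡ signum α ℕ.+ (signum β ℕ.+ k) ∸ (α ℕ.+ 1) / 2 ∸ β
  ω-exponent-iii 0 0 k _ _ = +-identityʳ k
  ω-exponent-iii 0 1 k _ _ = +-identityʳ k
  ω-exponent-iii 1 0 k _ _ = +-identityʳ k
  ω-exponent-iii 1 1 k _ _ = +-identityʳ k
  ω-exponent-iii 2 0 k _ _ = +-identityʳ k
  ω-exponent-iii 2 1 k _ _ = +-identityʳ k
  ω-exponent-iii (suc (suc (suc _))) _ _ (s≤s (s≤s ())) _
  ω-exponent-iii _ (suc (suc _)) _ _ (s≤s ())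

  ω-exponent-iv : ∀ α β k → 3 ≤ α → β ≤ 1 → k ℕ.+ 1 ≡ signum α ℕ.+ (signum β ℕ.+ k) ∸ β
  ω-exponent-iv (suc _) 0 k _ _ = +-comm k 1
  ω-exponent-iv (suc _) 1 k _ _ = +-comm k 1
  ω-exponent-iv _ (suc (suc _)) _ _ (s≤s ())

  module Theorem (α β k : ℕ) (k≥1 : 1 ≤ k) (p a : Fin k → ℕ) (p-injective : ∀ i j → p i ≡ p j → i ≡ j)
    (p-prime : ∀ i → Prime (p i)) (p⊥6 : ∀ i → gcd (p i) 6 ≡ 1) (a≥1 : ∀ i → 1 ≤ a i)
    (n : ℕ) (n≡ : n ≡ 2 ^ α ℕ.* 3 ^ β ℕ.* prodPow p a) where

    private
      e : Fin k → ℕ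
      e i = pred (a i)

      a≡ : ∀ i → a i ≡ suc (e i)
      a≡ i with a i | a≥1 i
      ... | suc _ | _ = refl

      r : Fin k → ℕ
      r i = p i % 12

      p≢2 : ∀ i → p i ≢ 2
      p≢2 i pᵢ≡2 = contradiction (trans (cong (λ x → gcd x 6) (sym pᵢ≡2)) (p⊥6 i)) λ ()

      p≢3 : ∀ i → p i ≢ 3
      p≢3 i pᵢ≡3 = contradiction (trans (cong (λ x → gcd x 6) (sym pᵢ≡3)) (p⊥6 i)) λ ()

      primes : Fin (suc (suc k)) → ℕ
      primes fzero = 2
      primes (fsuc fzero) = 3
      primes (fsuc (fsuc i)) = p i

      exponents : Fin (suc (suc k)) → ℕ
      exponents fzero = α
      exponents (fsuc fzero) = β
      exponents (fsuc (fsuc i)) = a i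

      primes-injective : ∀ i j → primes i ≡ primes j → i ≡ j
      primes-injective fzero fzero _ = refl
      primes-injective (fsuc fzero) (fsuc fzero) _ = refl
      primes-injective (fsuc (fsuc i)) (fsuc (fsuc j)) pᵢ≡pⱼ = cong (fsuc ∘ fsuc) (p-injective i j pᵢ≡pⱼ)
      primes-injective fzero (fsuc (fsuc j)) 2≡pⱼ = contradiction (sym 2≡pⱼ) (p≢2 j)
      primes-injective (fsuc (fsuc i)) fzero pᵢ≡2 = contradiction pᵢ≡2 (p≢2 i)
      primes-injective (fsuc fzero) (fsuc (fsuc j)) 3≡pⱼ = contradiction (sym 3≡pⱼ) (p≢3 j)
      primes-injective (fsuc (fsuc i)) (fsuc fzero) pᵢ≡3 = contradiction pᵢ≡3 (p≢3 i)
      primes-injective fzero (fsuc fzero) ()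
      primes-injective (fsuc fzero) fzero ()

      primes-prime : ∀ i → Prime (primes i)
      primes-prime fzero = prime[2]
      primes-prime (fsuc fzero) = prime[3]
      primes-prime (fsuc (fsuc i)) = p-prime i

      n≡prodPow : n ≡ prodPow primes exponents
      n≡prodPow = trans n≡ (*-assoc (2 ^ α) (3 ^ β) (prodPow p a))

      Ω-n : Ω n ≡ α ℕ.+ (β ℕ.+ sum (tabulate a))
      Ω-n = trans (cong Ω n≡prodPow) (Ω-prodPow primes exponents primes-injective primes-prime)

      ω-n : ω n ≡ signum α ℕ.+ (signum β ℕ.+ k)
      ω-n = trans (cong ω n≡prodPow) (trans (ω-prodPow primes exponents primes-injective primes-prime)
        (cong (λ z → signum α ℕ.+ (signum β ℕ.+ z)) (count k (signum ∘ a) (λ i → cong signum (a≡ i)))))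
        where
        count : ∀ k (s : Fin k → ℕ) → (∀ i → s i ≡ 1) → sum (tabulate s) ≡ k
        count zero _ _ = refl
        count (suc k) s s≡1 = cong₂ ℕ._+_ (s≡1 fzero) (count k (s ∘ fsuc) (s≡1 ∘ fsuc))

      sum-a : sum (tabulate a) ≡ sum (tabulate e) ℕ.+ k
      sum-a = shift k a e a≡
        where
        regroup : ∀ x S k → suc x ℕ.+ (S ℕ.+ k) ≡ x ℕ.+ S ℕ.+ suc k
        regroup = ℕSolver.solve-∀
        shift : ∀ k (a e : Fin k → ℕ) → (∀ i → a i ≡ suc (e i)) → sum (tabulate a) ≡ sum (tabulate e) ℕ.+ k
        shift zero _ _ _ = refl
        shift (suc k) a e a≡ = trans (cong₂ ℕ._+_ (a≡ fzero) (shift k (a ∘ fsuc) (e ∘ fsuc) (a≡ ∘ fsuc)))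
          (regroup (e fzero) (sum (tabulate (e ∘ fsuc))) k)

      p∤2^α3^β : ∀ i → ¬ p i ∣ 2 ^ α ℕ.* 3 ^ β
      p∤2^α3^β i p∣ with euclidsLemma (2 ^ α) (3 ^ β) (p-prime i) p∣
      ... | inj₁ p∣2^α = p≢2 i (prime∣^⇒≡ α (p-prime i) prime[2] p∣2^α)
      ... | inj₂ p∣3^β = p≢3 i (prime∣^⇒≡ β (p-prime i) prime[3] p∣3^β)

      X : ℤ
      X = + (12 ℕ.* φ[ 12 ] n) ℤ.- + (φ n)

      X≡run : X ≡ run r e (base α β) ! 1
      X≡run = begin
        + (12 ℕ.* φ[ 12 ] n) ℤ.- + (φ n)  ≡⟨ cong₂ (λ x y → + (12 ℕ.* x) ℤ.- + y) (cong (coprimeCount n ∘ (_/ 12)) (sym (ℕP.*-identityʳ n)))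
                                                                              (trans (cong (coprimeCount n) (n/1≡n n)) (sym (+-identityʳ _))) ⟩
        defect n 1                         ≡⟨ cong (λ m → defect m 1) (trans n≡ (cong (2 ^ α ℕ.* 3 ^ β ℕ.*_) (prodPow-cong p a≡))) ⟩
        defect (2 ^ α ℕ.* 3 ^ β ℕ.* prodPow p (suc ∘ e)) 1
          ≡⟨ represents-run p e p-injective p-prime (λ i → square-mod12 (p i) (p⊥6 i)) p∤2^α3^β (represents-base α β) 1 ⟩
        run r e (base α β) ! 1             ∎
        where open ≡-Reasoning

      X≡coefficient : (∀ i → NonTrivialUnit (r i)) →
        X ≡ coefficient r e ℤ.* valueAt1 α β (occurs 5 r) (occurs 7 r) (occurs 11 r)
      X≡coefficient units = trans X≡run (trans (cong (_! 1) (run-normalForm r e (base α β) units))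
        (scale-! (coefficient r e) (normalForm (base α β) (occurs 5 r) (occurs 7 r) (occurs 11 r)) 1))

      X-in-case : ∀ {h5 h7 h11 ε δ K} → ResiduesAre p (residueList h5 h7 h11) → Evaluates α β h5 h7 h11 ε δ K →
        X ≡ sgnℤ (Ω n ℕ.+ ε) ℤ.* + (K ℕ.* 2 ^ (k ℕ.+ δ))
      X-in-case {h5} {h7} {h11} {ε} {δ} {K} residues (evaluates value) = begin
        X                                                          ≡⟨ X≡coefficient units ⟩
        c ℤ.* valueAt1 α β (occurs 5 r) (occurs 7 r) (occurs 11 r) ≡⟨ cong (c ℤ.*_) (trans flags value) ⟩
        c ℤ.* (sgnℤ (α ℕ.+ β ℕ.+ ε) ℤ.* ((- + 2) ℤ.^ flagCount h5 h7 h11 ℤ.* P)) ≡⟨ regroup c (sgnℤ (α ℕ.+ β ℕ.+ ε)) ((- + 2) ℤ.^ flagCount h5 h7 h11) P ⟩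
        sgnℤ (α ℕ.+ β ℕ.+ ε) ℤ.* (c ℤ.* (- + 2) ℤ.^ flagCount h5 h7 h11) ℤ.* P
          ≡⟨ cong (λ z → sgnℤ (α ℕ.+ β ℕ.+ ε) ℤ.* z ℤ.* P) (trans (cong (λ s → c ℤ.* (- + 2) ℤ.^ s) (sym flagCount≡)) (coefficient-distinctUnits r e units)) ⟩
        sgnℤ (α ℕ.+ β ℕ.+ ε) ℤ.* (sgnℤ (sum (tabulate e)) ℤ.* (- + 2) ℤ.^ k) ℤ.* P ≡⟨ sgnℤ-collect (α ℕ.+ β ℕ.+ ε) (sum (tabulate e)) k K δ ⟩
        sgnℤ (α ℕ.+ β ℕ.+ ε ℕ.+ sum (tabulate e) ℕ.+ k) ℤ.* + (K ℕ.* 2 ^ (k ℕ.+ δ)) ≡⟨ cong (λ z → sgnℤ z ℤ.* + (K ℕ.* 2 ^ (k ℕ.+ δ))) exponent ⟩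
        sgnℤ (Ω n ℕ.+ ε) ℤ.* + (K ℕ.* 2 ^ (k ℕ.+ δ)) ∎
        where
        open ≡-Reasoning
        c P : ℤ
        c = coefficient r e
        P = + (K ℕ.* 2 ^ δ)
        units : ∀ i → NonTrivialUnit (r i)
        units = units-of-residues p {h5} {h7} {h11} residues
        o5 : occurs 5 r ≡ h5
        o5 = occurs-of-residues p {h5} {h7} {h11} residues five
        o7 : occurs 7 r ≡ h7
        o7 = occurs-of-residues p {h5} {h7} {h11} residues seven
        o11 : occurs 11 r ≡ h11
        o11 = occurs-of-residues p {h5} {h7} {h11} residues eleven
        flags : valueAt1 α β (occurs 5 r) (occurs 7 r) (occurs 11 r) ≡ valueAt1 α β h5 h7 h11
        flags = cong₂ (λ x (yz : _ × _) → valueAt1 α β x (proj₁ yz) (proj₂ yz)) o5 (cong₂ _,_ o7 o11)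
        flagCount≡ : distinctUnits r ≡ flagCount h5 h7 h11
        flagCount≡ = cong₂ (λ x (yz : _ × _) → flagCount x (proj₁ yz) (proj₂ yz)) o5 (cong₂ _,_ o7 o11)
        regroup : ∀ c s D P → c ℤ.* (s ℤ.* (D ℤ.* P)) ≡ s ℤ.* (c ℤ.* D) ℤ.* P
        regroup = ℤSolver.solve-∀
        shuffle : ∀ α β ε E k → α ℕ.+ β ℕ.+ ε ℕ.+ E ℕ.+ k ≡ α ℕ.+ (β ℕ.+ (E ℕ.+ k)) ℕ.+ ε
        shuffle = ℕSolver.solve-∀
        exponent : α ℕ.+ β ℕ.+ ε ℕ.+ sum (tabulate e) ℕ.+ k ≡ Ω n ℕ.+ ε
        exponent = trans (shuffle α β ε _ k) (cong (ℕ._+ ε) (sym (trans Ω-n (cong (λ z → α ℕ.+ (β ℕ.+ z)) sum-a))))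

      φ₁₂-in-case : ∀ {h5 h7 h11 ε δ K} (c : ℚ) {m x} → (1 ÷ 12) * ⟦ K ⟧ ≡ c → ResiduesAre p (residueList h5 h7 h11) →
        Evaluates α β h5 h7 h11 ε δ K → Ω n ℕ.+ ε ≡ m → k ℕ.+ δ ≡ x →
        ⟦ φ[ 12 ] n ⟧ ≡ (1 ÷ 12) * ⟦ φ n ⟧ + c * sgn m * ⟦ 2 ^ x ⟧
      φ₁₂-in-case {K = K} c {m} {x} c≡ residues value refl refl = begin
        ⟦ φ[ 12 ] n ⟧                                                ≡⟨ twelfths (φ[ 12 ] n) (φ n) (K ℕ.* 2 ^ x) m (X-in-case residues value) ⟩
        (1 ÷ 12) * ⟦ φ n ⟧ + (1 ÷ 12) * sgn m * ⟦ K ℕ.* 2 ^ x ⟧      ≡⟨ cong (λ z → (1 ÷ 12) * ⟦ φ n ⟧ + (1 ÷ 12) * sgn m * z) (⟦*⟧ K (2 ^ x)) ⟩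
        (1 ÷ 12) * ⟦ φ n ⟧ + (1 ÷ 12) * sgn m * (⟦ K ⟧ * ⟦ 2 ^ x ⟧)  ≡⟨ cong (_+_ ((1 ÷ 12) * ⟦ φ n ⟧)) (rearrange (1 ÷ 12) (sgn m) ⟦ K ⟧ ⟦ 2 ^ x ⟧) ⟩
        (1 ÷ 12) * ⟦ φ n ⟧ + (1 ÷ 12) * ⟦ K ⟧ * sgn m * ⟦ 2 ^ x ⟧    ≡⟨ cong (λ z → (1 ÷ 12) * ⟦ φ n ⟧ + z * sgn m * ⟦ 2 ^ x ⟧) c≡ ⟩
        (1 ÷ 12) * ⟦ φ n ⟧ + c * sgn m * ⟦ 2 ^ x ⟧                   ∎
        where
        open ≡-Reasoning
        open +-*-Solver using (solve; _:=_; _:*_)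
        rearrange : ∀ a s K P → a * s * (K * P) ≡ a * K * s * P
        rearrange = solve 4 (λ a s K P → a :* s :* (K :* P) := a :* K :* s :* P) refl

      ω-via : ∀ t {x} → x ≡ signum α ℕ.+ (signum β ℕ.+ k) ∸ t → x ≡ ω n ∸ t
      ω-via t x≡ = trans x≡ (cong (_∸ t) (sym ω-n))

      ω-via₂ : ∀ {x} → x ≡ signum α ℕ.+ (signum β ℕ.+ k) ∸ (α ℕ.+ 1) / 2 ∸ β → x ≡ ω n ∸ (α ℕ.+ 1) / 2 ∸ β
      ω-via₂ x≡ = trans x≡ (cong (λ z → z ∸ (α ℕ.+ 1) / 2 ∸ β) (sym ω-n))

    formula-i : Case-i α β p → ⟦ φ[ 12 ] n ⟧ ≡ (1 ÷ 12) * ⟦ φ n ⟧ + (1 ÷ 4) * sgn (Ω n) * ⟦ 2 ^ (ω n ∸ α) ⟧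
    formula-i (α≤1 , β≡0 , inj₁ residues) = φ₁₂-in-case (1 ÷ 4) refl residues (table-i α β true α≤1 β≡0)
      (+-identityʳ (Ω n)) (ω-via α (ω-exponent-i α β k α≤1 β≡0))
    formula-i (α≤1 , β≡0 , inj₂ residues) = φ₁₂-in-case (1 ÷ 4) refl residues (table-i α β false α≤1 β≡0)
      (+-identityʳ (Ω n)) (ω-via α (ω-exponent-i α β k α≤1 β≡0))

    formula-ii : Case-ii α β p → ⟦ φ[ 12 ] n ⟧ ≡ (1 ÷ 12) * ⟦ φ n ⟧ + (1 ÷ 4) * sgn (suc (Ω n)) * ⟦ 2 ^ (ω n ∸ α) ⟧
    formula-ii (α≤1 , 2≤β , inj₁ residues) = φ₁₂-in-case (1 ÷ 4) refl residues (table-ii α β true true α≤1 2≤β refl)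
      (+-comm (Ω n) 1) (ω-via α (ω-exponent-ii α β k α≤1 2≤β))
    formula-ii (α≤1 , 2≤β , inj₂ (inj₁ residues)) = φ₁₂-in-case (1 ÷ 4) refl residues (table-ii α β true false α≤1 2≤β refl)
      (+-comm (Ω n) 1) (ω-via α (ω-exponent-ii α β k α≤1 2≤β))
    formula-ii (α≤1 , 2≤β , inj₂ (inj₂ residues)) = φ₁₂-in-case (1 ÷ 4) refl residues (table-ii α β false true α≤1 2≤β refl)
      (+-comm (Ω n) 1) (ω-via α (ω-exponent-ii α β k α≤1 2≤β))

    formula-iii : Case-iii α β p →
      ⟦ φ[ 12 ] n ⟧ ≡ (1 ÷ 12) * ⟦ φ n ⟧ + (1 ÷ 6) * sgn (Ω n ℕ.+ (α ℕ.+ 1) / 2) * ⟦ 2 ^ (ω n ∸ (α ℕ.+ 1) / 2 ∸ β) ⟧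
    formula-iii (inj₁ (α≤2 , β≤1 , inj₁ residues)) = φ₁₂-in-case (1 ÷ 6) refl residues (table-iii-5 α β true α≤2 β≤1)
      refl (ω-via₂ (ω-exponent-iii α β k α≤2 β≤1))
    formula-iii (inj₁ (α≤2 , β≤1 , inj₂ residues)) = φ₁₂-in-case (1 ÷ 6) refl residues (table-iii-5 α β false α≤2 β≤1)
      refl (ω-via₂ (ω-exponent-iii α β k α≤2 β≤1))
    formula-iii (inj₂ (inj₁ (α≤1 , β≡1 , residues))) = φ₁₂-in-case (1 ÷ 6) refl residues (table-iii-11 α β (inj₁ (α≤1 , β≡1)))
      refl (ω-via₂ (ω-exponent-iii α β k (ℕP.m≤n⇒m≤1+n α≤1) (ℕP.≤-reflexive β≡1)))
    formula-iii (inj₂ (inj₂ (α≡2 , β≤1 , residues))) = φ₁₂-in-case (1 ÷ 6) refl residues (table-iii-11 α β (inj₂ (α≡2 , β≤1)))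
      refl (ω-via₂ (ω-exponent-iii α β k (ℕP.≤-reflexive α≡2) β≤1))

    formula-iv : Case-iv α β p → ⟦ φ[ 12 ] n ⟧ ≡ (1 ÷ 12) * ⟦ φ n ⟧ + (1 ÷ 6) * sgn (Ω n) * ⟦ 2 ^ (ω n ∸ β) ⟧
    formula-iv (3≤α , β≤1 , inj₁ residues) = φ₁₂-in-case (1 ÷ 6) refl residues (table-iv α β true true 3≤α β≤1 refl)
      (+-identityʳ (Ω n)) (ω-via β (ω-exponent-iv α β k 3≤α β≤1))
    formula-iv (3≤α , β≤1 , inj₂ (inj₁ residues)) = φ₁₂-in-case (1 ÷ 6) refl residues (table-iv α β true false 3≤α β≤1 refl)
      (+-identityʳ (Ω n)) (ω-via β (ω-exponent-iv α β k 3≤α β≤1))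
    formula-iv (3≤α , β≤1 , inj₂ (inj₂ residues)) = φ₁₂-in-case (1 ÷ 6) refl residues (table-iv α β false true 3≤α β≤1 refl)
      (+-identityʳ (Ω n)) (ω-via β (ω-exponent-iv α β k 3≤α β≤1))

    formula-v : Case-v α β p → ⟦ φ[ 12 ] n ⟧ ≡ (1 ÷ 12) * ⟦ φ n ⟧ + (5 ÷ 12) * sgn (Ω n) * ⟦ 2 ^ ω n ⟧
    formula-v (refl , refl , residues) = φ₁₂-in-case (5 ÷ 12) refl residues table-v
      (+-identityʳ (Ω n)) (ω-via 0 (+-identityʳ k))

    formula-vi : Case-vi α β p → ⟦ φ[ 12 ] n ⟧ ≡ (1 ÷ 12) * ⟦ φ n ⟧ + (1 ÷ 12) * sgn (Ω n) * ⟦ 2 ^ (ω n ∸ 1) ⟧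
    formula-vi (refl , refl , residues) = φ₁₂-in-case (1 ÷ 12) refl residues table-vi
      (+-identityʳ (Ω n)) (ω-via 1 (+-identityʳ k))

    formula-vii : ¬ CaseHolds α β p → ⟦ φ[ 12 ] n ⟧ ≡ (1 ÷ 12) * ⟦ φ n ⟧
    formula-vii ¬case = twelfths₀ (φ[ 12 ] n) (φ n) (X≡0 (some-or-all (λ i → residue-coprime6 (p i) (p⊥6 i))))
      where
      i₀ : Fin k
      i₀ = some k≥1
        where
        some : ∀ {k} → 1 ≤ k → Fin k
        some (s≤s _) = fzero
      X≡0 : (∃ λ i → r i ≡ 1) ⊎ (∀ i → NonTrivialUnit (r i)) → X ≡ + 0
      X≡0 (inj₁ rᵢ≡1) = trans X≡run (trans (cong (_! 1) (run-zeros r e (base α β) rᵢ≡1)) (zeros-! 1))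
      X≡0 (inj₂ units) = begin
        X                                                                     ≡⟨ X≡coefficient units ⟩
        coefficient r e ℤ.* valueAt1 α β (occurs 5 r) (occurs 7 r) (occurs 11 r) ≡⟨ cong (coefficient r e ℤ.*_) vanishes ⟩
        coefficient r e ℤ.* + 0                                               ≡⟨ ℤP.*-zeroʳ (coefficient r e) ⟩
        + 0                                                                   ∎
        where
        open ≡-Reasoning
        vanishes = outside-cases α β (occurs 5 r) (occurs 7 r) (occurs 11 r) (¬case ∘ caseFlags⇒case {p = p} (residues-of-units p units)) (occurs-some r i₀ (units i₀))

open import Data.Rational using (ℚ; _+_; _*_)

theorem4p2 : (α β k : ℕ) → 1 ≤ k →
    (p a : Fin k → ℕ) →
    (∀ i j → p i ≡ p j → i ≡ j) →
    (∀ i → Prime (p i)) →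
    (∀ i → gcd (p i) 6 ≡ 1) →
    (∀ i → 1 ≤ a i) →
    (n : ℕ) → n ≡ 2 ^ α ℕ.* 3 ^ β ℕ.* prodPow p a → 12 < n →
      (Case-i α β p → ⟦ φ[ 12 ] n ⟧ ≡ (1 ÷ 12) * ⟦ φ n ⟧
          + (1 ÷ 4) * sgn (Ω n) * ⟦ 2 ^ (ω n ∸ α) ⟧)
    × (Case-ii α β p → ⟦ φ[ 12 ] n ⟧ ≡ (1 ÷ 12) * ⟦ φ n ⟧
          + (1 ÷ 4) * sgn (ℕ.suc (Ω n)) * ⟦ 2 ^ (ω n ∸ α) ⟧)
    × (Case-iii α β p → ⟦ φ[ 12 ] n ⟧ ≡ (1 ÷ 12) * ⟦ φ n ⟧
          + (1 ÷ 6) * sgn (Ω n ℕ.+ (α ℕ.+ 1) / 2) * ⟦ 2 ^ (ω n ∸ (α ℕ.+ 1) / 2 ∸ β) ⟧)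
    × (Case-iv α β p → ⟦ φ[ 12 ] n ⟧ ≡ (1 ÷ 12) * ⟦ φ n ⟧
          + (1 ÷ 6) * sgn (Ω n) * ⟦ 2 ^ (ω n ∸ β) ⟧)
    × (Case-v α β p → ⟦ φ[ 12 ] n ⟧ ≡ (1 ÷ 12) * ⟦ φ n ⟧
          + (5 ÷ 12) * sgn (Ω n) * ⟦ 2 ^ ω n ⟧)
    × (Case-vi α β p → ⟦ φ[ 12 ] n ⟧ ≡ (1 ÷ 12) * ⟦ φ n ⟧
          + (1 ÷ 12) * sgn (Ω n) * ⟦ 2 ^ (ω n ∸ 1) ⟧)
    × (¬ (Case-i α β p ⊎ Case-ii α β p ⊎ Case-iii α β p ⊎ Case-iv α β p
           ⊎ Case-v α β p ⊎ Case-vi α β p)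
        → ⟦ φ[ 12 ] n ⟧ ≡ (1 ÷ 12) * ⟦ φ n ⟧)
theorem4p2 α β k k≥1 p a p-injective p-prime p⊥6 a≥1 n n≡ _ =
  formula-i , formula-ii , formula-iii , formula-iv , formula-v , formula-vi , formula-vii
  where open Formulas.Theorem α β k k≥1 p a p-injective p-prime p⊥6 a≥1 n n≡
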